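{- Let $L$ be a skew $(p,q)$-leaper with $\gcd(p,q)=1$ and let $m$ and $n$ be positive integers. When $L$ is free, the greatest length of a snake path or cycle in the leaper graph of $L$ on the board of size $m \times n$ does not exceed $\tau(L) \cdot mn + \mathcal{O}(m + n)$. When $L$ is half-free, it does not exceed $\tau(\operatorname{Free}(L))/2 \cdot mn + \mathcal{O}(m + n)$.
   Context: A $(p,q)$-leaper $L$ ($0\le p\le q$, not both zero) has leaper graph $\mathcal{G}(L,S)$ on $S\subseteq\mathbb{Z}^2$ with two cells adjacent iff $\{|x'-x''|,|y'-y''|\}=\{p,q\}$; the board of size $m\times n$ is $[0;n-1]\times[0;m-1]$. $L$ is skew if $0<p<q$. For $\gcd(p,q)=1$, $L$ is free if $p+q$ is odd and half-free if $p+q$ is even; for half-free $L$, $\operatorname{Free}(L)$ is the $((q-p)/2,(p+q)/2)$-leaper (which is free). A snake path (cycle) is a path (cycle) which is an induced subgraph; length = number of edges. A pseudosnake is an induced subgraph with all degrees at most $2$; for a free skew leaper $L'$, $\tau(L')=\lim_{n\to\infty}\tau_n$ where $\tau_n$ is the maximum number of vertices of a pseudosnake of $\mathcal{G}(L',[0;n-1]^2)$ divided by $n^2$ (this limit exists). Implied constants in $\mathcal{O}$ depend on $L$. -}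

module Defs where

open import Data.Nat using (ℕ; zero; suc; _+_; _*_; _∸_; _<_; _≤_; _%_; _/_; ∣_-_∣)
open import Data.Nat.GCD using (gcd)
open import Data.Integer using (+_)
open import Data.Rational using (ℚ) renaming (_/_ to _/ℚ_; _*_ to _*ℚ_; _+_ to _+ℚ_; _-_ to _-ℚ_; _≤_ to _≤ℚ_; _<_ to _<ℚ_)
open import Data.Product using (Σ; ∃; _×_; _,_)
open import Data.Sum using (_⊎_)
open import Relation.Nullary using (¬_)
open import Relation.Binary.PropositionalEquality using (_≡_; _≢_)

-- Cells of Z^2 restricted to ℕ^2 (boards live in the first quadrant).
Cell : Set
Cell = ℕ × ℕ

OnBoard : ℕ → ℕ → Cell → Set
OnBoard m n (x , y) = (x < n) × (y < m)

Adj : ℕ → ℕ → Cell → Cell → Set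
Adj p q (x₁ , y₁) (x₂ , y₂) =
  ((∣ x₁ - x₂ ∣ ≡ p) × (∣ y₁ - y₂ ∣ ≡ q)) ⊎ ((∣ x₁ - x₂ ∣ ≡ q) × (∣ y₁ - y₂ ∣ ≡ p))

SnakePath : ℕ → ℕ → ℕ → ℕ → ℕ → Set
SnakePath p q m n k =
  Σ (ℕ → Cell) λ v →
    (∀ i → i ≤ k → OnBoard m n (v i)) ×
    (∀ i j → i < j → j ≤ k → v i ≢ v j) ×
    (∀ i → i < k → Adj p q (v i) (v (suc i))) ×
    (∀ i j → i < j → j ≤ k → Adj p q (v i) (v j) → j ≡ suc i)

SnakeCycle : ℕ → ℕ → ℕ → ℕ → ℕ → Set
SnakeCycle p q m n k =
  (3 ≤ k) ×
  Σ (ℕ → Cell) λ v →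
    (∀ i → i < k → OnBoard m n (v i)) ×
    (∀ i j → i < j → j < k → v i ≢ v j) ×
    (∀ i → suc i < k → Adj p q (v i) (v (suc i))) ×
    Adj p q (v (k ∸ 1)) (v 0) ×
    (∀ i j → i < j → j < k → Adj p q (v i) (v j) →
       (j ≡ suc i) ⊎ ((i ≡ 0) × (j ≡ k ∸ 1)))

Snake : ℕ → ℕ → ℕ → ℕ → ℕ → Set
Snake p q m n k = SnakePath p q m n k ⊎ SnakeCycle p q m n k

Pseudosnake : ℕ → ℕ → ℕ → ℕ → Set
Pseudosnake p q N s =
  Σ (ℕ → Cell) λ w →
    (∀ i → i < s → OnBoard N N (w i)) ×
    (∀ i j → i < j → j < s → w i ≢ w j) ×
    (∀ i a b c → i < s → a < s → b < s → c < s → a < b → b < c →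
       ¬ (Adj p q (w i) (w a) × Adj p q (w i) (w b) × Adj p q (w i) (w c)))

toℚ : ℕ → ℚ
toℚ k = (+ k) /ℚ 1

-- "τ(L) < r" for the (p,q)-leaper L, where τ(L) = lim τ_N and τ_N is the maximum
-- number of vertices of a pseudosnake on the N × N board divided by N²:
-- there are a rational δ > 0 and N₀ with τ_N ≤ r - δ for all N ≥ N₀.
TauBelow : ℕ → ℕ → ℚ → Set
TauBelow p q r =
  Σ ℚ λ δ → (toℚ 0 <ℚ δ) × Σ ℕ λ N₀ →
    ∀ N → N₀ ≤ N → ∀ s → Pseudosnake p q N s →
      toℚ s ≤ℚ ((r -ℚ δ) *ℚ toℚ (N * N))

IsFree : ℕ → ℕ → Set
IsFree p q = (p + q) % 2 ≡ 1

IsHalfFree : ℕ → ℕ → Set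
IsHalfFree p q = (p + q) % 2 ≡ 0

freeP freeQ : ℕ → ℕ → ℕ
freeP p q = (q ∸ p) / 2
freeQ p q = (p + q) / 2

-- A snake on the m × n board is a pseudosnake whose vertices lie on one walk.  Placing copies of it at
-- mutual distance more than q tiles a large square with a pseudosnake, so the density τ of pseudosnakes
-- bounds its number of cells by τ · (m + q)(n + q) = τ mn + O(m + n).  For half-free L every move of L
-- preserves the parity of x + y, and the rotation (x , y) ↦ ((x + y) / 2 , (x − y) / 2) carries one
-- parity class onto ℤ² and L onto Free(L); copies placed on a diamond of blocks then rotate into a
-- square of half the area, which yields the factor τ(Free(L)) / 2.
module Submission where

open import Defs
open import Data.Nat using (ℕ; zero; suc; pred; _+_; _*_; _∸_; _<_; _≤_; z≤n; s≤s; ∣_-_∣; _%_; _/_; _≟_; <-cmp; NonZero; >-nonZero)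
import Data.Nat.Properties as ℕ
open import Data.Nat.DivMod using (m≡m%n+[m/n]*n; [m+kn]%n≡m%n; m/n*n≡m; %-distribˡ-+; m*n≤o⇒[o∸m*n]%n≡o%n; m<n*o⇒m/o<n; m%n<n; m/n*n≤m)
open import Data.Nat.Divisibility using (m%n≡0⇒n∣m)
open import Data.Nat.Coprimality using (1-coprimeTo) renaming (sym to coprime-sym)
open import Data.Nat.GCD using (gcd)
import Data.Nat.Solver as ℕ-Solver
open import Data.Integer as ℤ using (ℤ; +_; -[1+_]; _⊖_)
import Data.Integer.Properties as ℤ
import Data.Integer.Solver as ℤ-Solver
open import Data.Rational as ℚ using (ℚ; mkℚ; ½; 0ℚ; 1ℚ; NonNegative; Positive)
  renaming (_*_ to _*ℚ_; _+_ to _+ℚ_; _-_ to _-ℚ_; _≤_ to _≤ℚ_; _<_ to _<ℚ_)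
import Data.Rational.Properties as ℚ
import Data.Rational.Solver as ℚ-Solver
open import Data.Fin using (Fin; toℕ; fromℕ<; combine)
import Data.Fin.Properties as Fin
open import Data.Product using (Σ; ∃; ∃₂; _×_; _,_; proj₁; proj₂)
open import Data.Product.Properties using (≡-dec)
open import Data.Sum using (_⊎_; inj₁; inj₂)
open import Data.Empty using (⊥; ⊥-elim)
open import Relation.Nullary using (¬_; yes; no)
open import Relation.Binary using (tri<; tri≈; tri>)
open import Relation.Binary.PropositionalEquality
open import Data.List using (List; []; _∷_; length; map; upTo; cartesianProduct; _++_)
open import Data.List.Properties using (length-map; length-++; length-upTo)
open import Data.List.Membership.Propositional using (_∈_)
open import Data.List.Membership.Propositional.Properties using (∈-map⁻; ∈-upTo⁻; ∈-cartesianProduct⁻; ∈-++⁻)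
open import Data.List.Relation.Unary.Any using (here; there)
open import Data.List.Relation.Unary.All as All using (All; []; _∷_)
import Data.List.Relation.Unary.All.Properties as All
open import Data.List.Relation.Unary.Unique.Propositional using (Unique; []; _∷_)
import Data.List.Relation.Unary.Unique.Propositional.Properties as Unique

toℚ≡mkℚ : ∀ k → toℚ k ≡ mkℚ (+ k) 0 (coprime-sym (1-coprimeTo k))
toℚ≡mkℚ k = ℚ.normalize-coprime (coprime-sym (1-coprimeTo k))

toℚ-+ : ∀ a b → toℚ (a + b) ≡ toℚ a +ℚ toℚ b
toℚ-+ a b rewrite toℚ≡mkℚ a | toℚ≡mkℚ b =
  sym (cong (λ z → z ℚ./ 1) (cong₂ ℤ._+_ (ℤ.*-identityʳ (+ a)) (ℤ.*-identityʳ (+ b))))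

toℚ-* : ∀ a b → toℚ (a * b) ≡ toℚ a *ℚ toℚ b
toℚ-* a b rewrite toℚ≡mkℚ a | toℚ≡mkℚ b = cong (λ z → z ℚ./ 1) (ℤ.pos-* a b)

toℚ-mono-≤ : ∀ {a b} → a ≤ b → toℚ a ≤ℚ toℚ b
toℚ-mono-≤ {a} {b} a≤b rewrite toℚ≡mkℚ a | toℚ≡mkℚ b =
  ℚ.*≤* (subst₂ ℤ._≤_ (sym (ℤ.*-identityʳ (+ a))) (sym (ℤ.*-identityʳ (+ b))) (ℤ.+≤+ a≤b))

toℚ-nonNeg : ∀ k → NonNegative (toℚ k)
toℚ-nonNeg k = ℚ.nonNegative (toℚ-mono-≤ {0} {k} z≤n)

toℚ-pos : ∀ k .{{_ : NonZero k}} → Positive (toℚ k)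
toℚ-pos (suc k) rewrite toℚ≡mkℚ (suc k) = _

archimedean : ∀ (x : ℚ) → Σ ℕ λ N → x ≤ℚ toℚ N
archimedean (mkℚ (+ k) d c) = k , x≤k
  where
  x≤k : mkℚ (+ k) d c ≤ℚ toℚ k
  x≤k rewrite toℚ≡mkℚ k =
    ℚ.*≤* (subst₂ ℤ._≤_ (ℤ.pos-* k 1) (ℤ.pos-* k (suc d)) (ℤ.+≤+ (ℕ.*-monoʳ-≤ k (s≤s z≤n))))
archimedean (mkℚ -[1+ k ] d c) = 0 , ℚ.*≤* ℤ.-≤+

0<⇒nonNeg : ∀ {δ} → 0ℚ <ℚ δ → NonNegative δ
0<⇒nonNeg 0<δ = ℚ.nonNegative (ℚ.<⇒≤ 0<δ)

archimedean-* : ∀ r δ → 0ℚ <ℚ δ → ∀ M → Σ ℕ λ N → (M ≤ N) × (r ≤ℚ δ *ℚ toℚ N)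
archimedean-* r δ 0<δ M = M + N₀ , ℕ.m≤m+n M N₀ , r≤δN
  where
  instance
    δ-pos : Positive δ
    δ-pos = ℚ.positive 0<δ
    δ-nonZero : ℚ.NonZero δ
    δ-nonZero = ℚ.pos⇒nonZero δ
  N₀ = proj₁ (archimedean (r *ℚ ℚ.1/ δ))
  r≤δN : r ≤ℚ δ *ℚ toℚ (M + N₀)
  r≤δN = begin
    r                        ≡⟨ sym (ℚ.*-identityʳ r) ⟩
    r *ℚ 1ℚ                  ≡⟨ cong (r *ℚ_) (sym (ℚ.*-inverseʳ δ)) ⟩
    r *ℚ (δ *ℚ ℚ.1/ δ)       ≡⟨ solve 3 (λ r d i → r :* (d :* i) := d :* (r :* i)) refl r δ (ℚ.1/ δ) ⟩
    δ *ℚ (r *ℚ ℚ.1/ δ)       ≤⟨ ℚ.*-monoˡ-≤-nonNeg δ {{0<⇒nonNeg 0<δ}} (proj₂ (archimedean (r *ℚ ℚ.1/ δ))) ⟩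
    δ *ℚ toℚ N₀              ≤⟨ ℚ.*-monoˡ-≤-nonNeg δ {{0<⇒nonNeg 0<δ}} (toℚ-mono-≤ (ℕ.m≤n+m N₀ M)) ⟩
    δ *ℚ toℚ (M + N₀)        ∎
    where
    open ℚ.≤-Reasoning
    open ℚ-Solver.+-*-Solver

toℚ-*-cancelˡ-≤ : ∀ c V D R → 0 < c → toℚ (c * V) ≤ℚ R *ℚ toℚ (c * D) → toℚ V ≤ℚ R *ℚ toℚ D
toℚ-*-cancelˡ-≤ c V D R 0<c cV≤RcD = ℚ.*-cancelˡ-≤-pos (toℚ c) {{toℚ-pos c {{>-nonZero 0<c}}}} (begin
  toℚ c *ℚ toℚ V          ≡⟨ sym (toℚ-* c V) ⟩
  toℚ (c * V)             ≤⟨ cV≤RcD ⟩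
  R *ℚ toℚ (c * D)        ≡⟨ cong (R *ℚ_) (toℚ-* c D) ⟩
  R *ℚ (toℚ c *ℚ toℚ D)   ≡⟨ solve 3 (λ r c d → r :* (c :* d) := c :* (r :* d)) refl R (toℚ c) (toℚ D) ⟩
  toℚ c *ℚ (R *ℚ toℚ D)   ∎)
  where
  open ℚ.≤-Reasoning
  open ℚ-Solver.+-*-Solver

[r-δ]*x≤r*x : ∀ r δ x .{{_ : NonNegative x}} → 0ℚ <ℚ δ → (r -ℚ δ) *ℚ x ≤ℚ r *ℚ x
[r-δ]*x≤r*x r δ x 0<δ = ℚ.*-monoʳ-≤-nonNeg x (begin
  r -ℚ δ     ≤⟨ ℚ.+-monoʳ-≤ r (ℚ.neg-antimono-≤ (ℚ.<⇒≤ 0<δ)) ⟩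
  r +ℚ 0ℚ    ≡⟨ ℚ.+-identityʳ r ⟩
  r          ∎)
  where
  open ℚ.≤-Reasoning

density-nonNeg : ∀ s V D → 1 ≤ V → toℚ V ≤ℚ s *ℚ toℚ D → 0ℚ ≤ℚ s
density-nonNeg s V D 1≤V V≤sD with ℚ.≤-total 0ℚ s
... | inj₁ 0≤s = 0≤s
... | inj₂ s≤0 = ⊥-elim (1≰0 (begin
  1ℚ                 ≤⟨ toℚ-mono-≤ 1≤V ⟩
  toℚ V              ≤⟨ V≤sD ⟩
  s *ℚ toℚ D         ≤⟨ ℚ.*-monoʳ-≤-nonNeg (toℚ D) {{toℚ-nonNeg D}} s≤0 ⟩
  0ℚ *ℚ toℚ D        ≡⟨ ℚ.*-zeroˡ (toℚ D) ⟩
  0ℚ                 ∎))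
  where
  open ℚ.≤-Reasoning
  1≰0 : ¬ (1ℚ ≤ℚ 0ℚ)
  1≰0 (ℚ.*≤* (ℤ.+≤+ ()))

enlarged-area-≤ : ∀ m n c → 1 ≤ m + n → (m + c) * (n + c) ≤ m * n + (c + c * c) * (m + n)
enlarged-area-≤ m n c 1≤m+n = begin
  (m + c) * (n + c)                     ≡⟨ solve 3 (λ m n c → (m :+ c) :* (n :+ c) := m :* n :+ c :* (m :+ n) :+ c :* c :* con 1) refl m n c ⟩
  m * n + c * (m + n) + c * c * 1       ≤⟨ ℕ.+-monoʳ-≤ (m * n + c * (m + n)) (ℕ.*-monoʳ-≤ (c * c) 1≤m+n) ⟩
  m * n + c * (m + n) + c * c * (m + n) ≡⟨ solve 3 (λ m n c → m :* n :+ c :* (m :+ n) :+ c :* c :* (m :+ n) := m :* n :+ (c :+ c :* c) :* (m :+ n)) refl m n c ⟩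
  m * n + (c + c * c) * (m + n)         ∎
  where
  open ℕ.≤-Reasoning
  open ℕ-Solver.+-*-Solver

x≤x+toℚ : ∀ x k → x ≤ℚ x +ℚ toℚ k
x≤x+toℚ x k = begin
  x             ≡⟨ sym (ℚ.+-identityʳ x) ⟩
  x +ℚ 0ℚ       ≤⟨ ℚ.+-monoʳ-≤ x (toℚ-mono-≤ {0} {k} z≤n) ⟩
  x +ℚ toℚ k    ∎
  where
  open ℚ.≤-Reasoning

enlarged-box-bound : ∀ (s : ℚ) c k V m n D → 1 ≤ V → k ≤ V → k ≤ m * n → 1 ≤ m + n →
  D ≤ (m + c) * (n + c) → toℚ V ≤ℚ s *ℚ toℚ D →
  toℚ k ≤ℚ (s *ℚ toℚ (m * n)) +ℚ (toℚ (c + c * c) *ℚ toℚ (m + n))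
enlarged-box-bound s c k V m n D 1≤V k≤V k≤mn 1≤m+n D≤ V≤sD
  rewrite sym (toℚ-* (c + c * c) (m + n)) with ℚ.≤-total 1ℚ s
... | inj₁ 1≤s = begin
  toℚ k                 ≤⟨ toℚ-mono-≤ k≤mn ⟩
  toℚ (m * n)           ≡⟨ sym (ℚ.*-identityˡ (toℚ (m * n))) ⟩
  1ℚ *ℚ toℚ (m * n)     ≤⟨ ℚ.*-monoʳ-≤-nonNeg (toℚ (m * n)) {{toℚ-nonNeg (m * n)}} 1≤s ⟩
  s *ℚ toℚ (m * n)      ≤⟨ x≤x+toℚ (s *ℚ toℚ (m * n)) F ⟩
  s *ℚ toℚ (m * n) +ℚ toℚ F ∎
  where
  open ℚ.≤-Reasoning
  F : ℕ
  F = (c + c * c) * (m + n)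
... | inj₂ s≤1 = begin
  toℚ k                                  ≤⟨ toℚ-mono-≤ k≤V ⟩
  toℚ V                                  ≤⟨ V≤sD ⟩
  s *ℚ toℚ D                             ≤⟨ ℚ.*-monoˡ-≤-nonNeg s {{ℚ.nonNegative (density-nonNeg s V D 1≤V V≤sD)}}
                                              (toℚ-mono-≤ (ℕ.≤-trans D≤ (enlarged-area-≤ m n c 1≤m+n))) ⟩
  s *ℚ toℚ (m * n + F)                   ≡⟨ cong (s *ℚ_) (toℚ-+ (m * n) F) ⟩
  s *ℚ (toℚ (m * n) +ℚ toℚ F)            ≡⟨ ℚ.*-distribˡ-+ s (toℚ (m * n)) (toℚ F) ⟩
  s *ℚ toℚ (m * n) +ℚ s *ℚ toℚ F         ≤⟨ ℚ.+-monoʳ-≤ (s *ℚ toℚ (m * n)) (ℚ.*-monoʳ-≤-nonNeg (toℚ F) {{toℚ-nonNeg F}} s≤1) ⟩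
  s *ℚ toℚ (m * n) +ℚ 1ℚ *ℚ toℚ F        ≡⟨ cong (s *ℚ toℚ (m * n) +ℚ_) (ℚ.*-identityˡ (toℚ F)) ⟩
  s *ℚ toℚ (m * n) +ℚ toℚ F              ∎
  where
  open ℚ.≤-Reasoning
  F : ℕ
  F = (c + c * c) * (m + n)

[r-δ]*[1+t]≤r*t : ∀ r δ t → r ≤ℚ δ *ℚ toℚ (suc t) → (r -ℚ δ) *ℚ toℚ (suc t) ≤ℚ r *ℚ toℚ t
[r-δ]*[1+t]≤r*t r δ t r≤δ[1+t] = begin
  (r -ℚ δ) *ℚ toℚ (suc t)                    ≡⟨ cong ((r -ℚ δ) *ℚ_) (toℚ-+ 1 t) ⟩
  (r -ℚ δ) *ℚ (1ℚ +ℚ toℚ t)                  ≡⟨ solve 3 (λ r d u → (r :- d) :* (con 1ℚ :+ u) := r :* u :+ (r :- d :* (con 1ℚ :+ u))) refl r δ (toℚ t) ⟩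
  r *ℚ toℚ t +ℚ (r -ℚ δ *ℚ (1ℚ +ℚ toℚ t))    ≡⟨ cong (λ x → r *ℚ toℚ t +ℚ (r -ℚ δ *ℚ x)) (sym (toℚ-+ 1 t)) ⟩
  r *ℚ toℚ t +ℚ (r -ℚ δ *ℚ toℚ (suc t))      ≤⟨ ℚ.+-monoʳ-≤ (r *ℚ toℚ t) (ℚ.+-monoˡ-≤ (ℚ.- (δ *ℚ toℚ (suc t))) r≤δ[1+t]) ⟩
  r *ℚ toℚ t +ℚ (δ *ℚ toℚ (suc t) -ℚ δ *ℚ toℚ (suc t))
                                             ≡⟨ cong (r *ℚ toℚ t +ℚ_) (ℚ.+-inverseʳ (δ *ℚ toℚ (suc t))) ⟩
  r *ℚ toℚ t +ℚ 0ℚ                           ≡⟨ ℚ.+-identityʳ (r *ℚ toℚ t) ⟩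
  r *ℚ toℚ t                                 ∎
  where
  open ℚ.≤-Reasoning
  open ℚ-Solver.+-*-Solver

halve-density : ∀ r δ t' V D → 1 ≤ t' → 1 ≤ D → r ≤ℚ δ *ℚ toℚ (suc t') →
  toℚ ((suc t' * suc t' + t' * t') * (D * V)) ≤ℚ (r -ℚ δ) *ℚ toℚ ((suc t' * D) * (suc t' * D)) →
  toℚ V ≤ℚ (r *ℚ ½) *ℚ toℚ D
halve-density r δ t' V D 1≤t' 1≤D r≤δt count≤ = begin
  toℚ V                  ≡⟨ sym (ℚ.*-identityˡ (toℚ V)) ⟩
  1ℚ *ℚ toℚ V            ≡⟨ ℚ.*-assoc ½ (toℚ 2) (toℚ V) ⟩
  ½ *ℚ (toℚ 2 *ℚ toℚ V)  ≡⟨ cong (½ *ℚ_) (sym (toℚ-* 2 V)) ⟩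
  ½ *ℚ toℚ (2 * V)       ≤⟨ ℚ.*-monoˡ-≤-nonNeg ½ (toℚ-*-cancelˡ-≤ t' (2 * V) D r 1≤t' (ℚ.≤-trans 2t'V≤ shrink)) ⟩
  ½ *ℚ (r *ℚ toℚ D)      ≡⟨ sym (ℚ.*-assoc ½ r (toℚ D)) ⟩
  (½ *ℚ r) *ℚ toℚ D      ≡⟨ cong (_*ℚ toℚ D) (ℚ.*-comm ½ r) ⟩
  (r *ℚ ½) *ℚ toℚ D      ∎
  where
  open ℚ.≤-Reasoning
  t : ℕ
  t = suc t'
  -- t² + t'² = 2tt' + 1: cancel t D from (t D)(t' · 2V) ≤ (r − δ)(t D)², use (r − δ)t ≤ r t', cancel t'.
  split-count : (t * t + t' * t') * (D * V) ≡ (t * D) * (t' * (2 * V)) + D * V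
  split-count = solve 3 (λ u d v →
      ((con 1 :+ u) :* (con 1 :+ u) :+ u :* u) :* (d :* v) := ((con 1 :+ u) :* d) :* (u :* (con 2 :* v)) :+ d :* v)
    refl t' D V
    where
    open ℕ-Solver.+-*-Solver
  2t'V≤ : toℚ (t' * (2 * V)) ≤ℚ (r -ℚ δ) *ℚ toℚ (t * D)
  2t'V≤ = toℚ-*-cancelˡ-≤ (t * D) (t' * (2 * V)) (t * D) (r -ℚ δ) (ℕ.*-mono-≤ {1} {t} {1} {D} (s≤s z≤n) 1≤D)
    (ℚ.≤-trans (toℚ-mono-≤ (ℕ.≤-trans (ℕ.m≤m+n ((t * D) * (t' * (2 * V))) (D * V)) (ℕ.≤-reflexive (sym split-count)))) count≤)
  shrink : (r -ℚ δ) *ℚ toℚ (t * D) ≤ℚ r *ℚ toℚ (t' * D)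
  shrink = begin
    (r -ℚ δ) *ℚ toℚ (t * D)            ≡⟨ cong ((r -ℚ δ) *ℚ_) (toℚ-* t D) ⟩
    (r -ℚ δ) *ℚ (toℚ t *ℚ toℚ D)       ≡⟨ sym (ℚ.*-assoc (r -ℚ δ) (toℚ t) (toℚ D)) ⟩
    ((r -ℚ δ) *ℚ toℚ t) *ℚ toℚ D       ≤⟨ ℚ.*-monoʳ-≤-nonNeg (toℚ D) {{toℚ-nonNeg D}} ([r-δ]*[1+t]≤r*t r δ t' r≤δt) ⟩
    (r *ℚ toℚ t') *ℚ toℚ D             ≡⟨ ℚ.*-assoc r (toℚ t') (toℚ D) ⟩
    r *ℚ (toℚ t' *ℚ toℚ D)             ≡⟨ cong (r *ℚ_) (sym (toℚ-* t' D)) ⟩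
    r *ℚ toℚ (t' * D)                  ∎

Adj-sym : ∀ {p q} a b → Adj p q a b → Adj p q b a
Adj-sym (x₁ , y₁) (x₂ , y₂) (inj₁ (dx , dy)) = inj₁ (trans (ℕ.∣-∣-comm x₂ x₁) dx , trans (ℕ.∣-∣-comm y₂ y₁) dy)
Adj-sym (x₁ , y₁) (x₂ , y₂) (inj₂ (dx , dy)) = inj₂ (trans (ℕ.∣-∣-comm x₂ x₁) dx , trans (ℕ.∣-∣-comm y₂ y₁) dy)

Adj-irrefl : ∀ {p q} → 0 < p → 0 < q → ∀ a → ¬ Adj p q a a
Adj-irrefl 0<p 0<q (x , y) (inj₁ (dx , _)) = ℕ.<-irrefl (trans (sym (ℕ.∣n-n∣≡0 x)) dx) 0<p
Adj-irrefl 0<p 0<q (x , y) (inj₂ (dx , _)) = ℕ.<-irrefl (trans (sym (ℕ.∣n-n∣≡0 x)) dx) 0<q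

Adj-translate⁻ : ∀ {p q} a b x y x' y' → Adj p q (a + x , b + y) (a + x' , b + y') → Adj p q (x , y) (x' , y')
Adj-translate⁻ a b x y x' y' (inj₁ (dx , dy)) =
  inj₁ (trans (sym (ℕ.∣m+n-m+o∣≡∣n-o∣ a x x')) dx , trans (sym (ℕ.∣m+n-m+o∣≡∣n-o∣ b y y')) dy)
Adj-translate⁻ a b x y x' y' (inj₂ (dx , dy)) =
  inj₂ (trans (sym (ℕ.∣m+n-m+o∣≡∣n-o∣ a x x')) dx , trans (sym (ℕ.∣m+n-m+o∣≡∣n-o∣ b y y')) dy)

far⇒¬Adj : ∀ {p q} → p ≤ q → ∀ c c' →
  (q < ∣ proj₁ c - proj₁ c' ∣) ⊎ (q < ∣ proj₂ c - proj₂ c' ∣) → ¬ Adj p q c c'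
far⇒¬Adj p≤q _ _ (inj₁ far) (inj₁ (dx , _)) = ℕ.<⇒≱ far (subst (_≤ _) (sym dx) p≤q)
far⇒¬Adj p≤q _ _ (inj₁ far) (inj₂ (dx , _)) = ℕ.<-irrefl (sym dx) far
far⇒¬Adj p≤q _ _ (inj₂ far) (inj₁ (_ , dy)) = ℕ.<-irrefl (sym dy) far
far⇒¬Adj p≤q _ _ (inj₂ far) (inj₂ (_ , dy)) = ℕ.<⇒≱ far (subst (_≤ _) (sym dy) p≤q)

record ConnectedPseudosnake (p q m n V : ℕ) : Set where
  field
    cell      : ℕ → Cell
    on-board  : ∀ i → i < V → OnBoard m n (cell i)
    injective : ∀ i j → i < V → j < V → cell i ≡ cell j → i ≡ j
    degree≤2  : ∀ i a b c → i < V → a < V → b < V → c < V → a ≢ b → b ≢ c → a ≢ c →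
                Adj p q (cell i) (cell a) → Adj p q (cell i) (cell b) → Adj p q (cell i) (cell c) → ⊥
    walk      : ∀ i → suc i < V → Adj p q (cell i) (cell (suc i))

no-three-in-two-subsingletons : ∀ {A : Set} {P Q : A → Set} →
  (∀ {x y} → P x → P y → x ≡ y) → (∀ {x y} → Q x → Q y → x ≡ y) →
  ∀ {a b c} → P a ⊎ Q a → P b ⊎ Q b → P c ⊎ Q c → a ≢ b → b ≢ c → a ≢ c → ⊥
no-three-in-two-subsingletons uP uQ (inj₁ a) (inj₁ b) _ a≢b _ _ = a≢b (uP a b)
no-three-in-two-subsingletons uP uQ (inj₂ a) (inj₂ b) _ a≢b _ _ = a≢b (uQ a b)
no-three-in-two-subsingletons uP uQ (inj₁ a) (inj₂ b) (inj₁ c) _ _ a≢c = a≢c (uP a c)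
no-three-in-two-subsingletons uP uQ (inj₁ a) (inj₂ b) (inj₂ c) _ b≢c _ = b≢c (uQ b c)
no-three-in-two-subsingletons uP uQ (inj₂ a) (inj₁ b) (inj₁ c) _ b≢c _ = b≢c (uP b c)
no-three-in-two-subsingletons uP uQ (inj₂ a) (inj₁ b) (inj₂ c) _ _ a≢c = a≢c (uQ a c)

distinct⇒injective : ∀ (v : ℕ → Cell) V → (∀ i j → i < j → j < V → v i ≢ v j) →
  ∀ i j → i < V → j < V → v i ≡ v j → i ≡ j
distinct⇒injective v V distinct i j i<V j<V vi≡vj with <-cmp i j
... | tri< i<j _ _ = ⊥-elim (distinct i j i<j j<V vi≡vj)
... | tri≈ _ i≡j _ = i≡j
... | tri> _ _ j<i = ⊥-elim (distinct j i j<i i<V (sym vi≡vj))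

cyclic-pred : ℕ → ℕ → ℕ
cyclic-pred k zero    = k ∸ 1
cyclic-pred k (suc i) = i

cyclic-pred-injective : ∀ {k a b} → a < k → b < k → cyclic-pred k a ≡ cyclic-pred k b → a ≡ b
cyclic-pred-injective {_}     {zero}  {zero}  _         _         _ = refl
cyclic-pred-injective {suc k} {zero}  {suc b} _         (s≤s b<k) e = ⊥-elim (ℕ.<-irrefl (sym e) b<k)
cyclic-pred-injective {suc k} {suc a} {zero}  (s≤s a<k) _         e = ⊥-elim (ℕ.<-irrefl e a<k)
cyclic-pred-injective {_}     {suc a} {suc b} _         _         e = cong suc e

module _ {p q m n k : ℕ} (0<p : 0 < p) (0<q : 0 < q) where

  path⇒connectedPseudosnake : SnakePath p q m n k → ConnectedPseudosnake p q m n (suc k)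
  path⇒connectedPseudosnake (v , on-board , distinct , step , induced) = record
    { cell      = v
    ; on-board  = λ i i≤k → on-board i (ℕ.≤-pred i≤k)
    ; injective = distinct⇒injective v (suc k) (λ i j i<j j≤k → distinct i j i<j (ℕ.≤-pred j≤k))
    ; degree≤2  = λ i a b c i≤k a≤k b≤k c≤k a≢b b≢c a≢c ia ib ic →
        no-three-in-two-subsingletons (λ x y → trans x (sym y)) (λ x y → trans x (sym y))
          (neighbour i a i≤k a≤k ia) (neighbour i b i≤k b≤k ib) (neighbour i c i≤k c≤k ic) a≢b b≢c a≢c
    ; walk      = λ i i<k → step i (ℕ.≤-pred i<k)
    }
    where
    neighbour : ∀ i a → i < suc k → a < suc k → Adj p q (v i) (v a) → (a ≡ suc i) ⊎ (a ≡ pred i)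
    neighbour i a i≤k a≤k adj with <-cmp i a
    ... | tri< i<a _ _ = inj₁ (induced i a i<a (ℕ.≤-pred a≤k) adj)
    ... | tri≈ _ refl _ = ⊥-elim (Adj-irrefl 0<p 0<q (v i) adj)
    ... | tri> _ _ a<i = inj₂ (cong pred (sym (induced a i a<i (ℕ.≤-pred i≤k) (Adj-sym (v i) (v a) adj))))

  cycle⇒connectedPseudosnake : SnakeCycle p q m n k → ConnectedPseudosnake p q m n k
  cycle⇒connectedPseudosnake (_ , v , on-board , distinct , step , _ , induced) = record
    { cell      = v
    ; on-board  = on-board
    ; injective = distinct⇒injective v k distinct
    ; degree≤2  = λ i a b c i<k a<k b<k c<k a≢b b≢c a≢c ia ib ic →
        no-three-in-two-subsingletons (λ x y → trans x (sym y))
          (λ (x<k , i≡x⁻) (y<k , i≡y⁻) → cyclic-pred-injective x<k y<k (trans (sym i≡x⁻) i≡y⁻))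
          (neighbour i a i<k a<k ia) (neighbour i b i<k b<k ib) (neighbour i c i<k c<k ic) a≢b b≢c a≢c
    ; walk      = step
    }
    where
    neighbour : ∀ i a → i < k → a < k → Adj p q (v i) (v a) →
                (a ≡ cyclic-pred k i) ⊎ ((a < k) × (i ≡ cyclic-pred k a))
    neighbour i a i<k a<k adj with <-cmp i a
    ... | tri≈ _ refl _ = ⊥-elim (Adj-irrefl 0<p 0<q (v i) adj)
    ... | tri< i<a _ _ with induced i a i<a a<k adj
    ...   | inj₁ refl          = inj₂ (a<k , refl)
    ...   | inj₂ (refl , refl) = inj₁ refl
    neighbour i a i<k a<k adj | tri> _ _ a<i with induced a i a<i i<k (Adj-sym (v i) (v a) adj)
    ...   | inj₁ refl          = inj₁ refl
    ...   | inj₂ (refl , refl) = inj₂ (a<k , refl)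

  snake⇒connectedPseudosnake : Snake p q m n k → Σ ℕ λ V → ConnectedPseudosnake p q m n V × (k ≤ V) × (1 ≤ V)
  snake⇒connectedPseudosnake (inj₁ path)  = suc k , path⇒connectedPseudosnake path , ℕ.n≤1+n k , s≤s z≤n
  snake⇒connectedPseudosnake (inj₂ cycle) = k , cycle⇒connectedPseudosnake cycle , ℕ.≤-refl , ℕ.≤-trans (s≤s z≤n) (proj₁ cycle)

injection-into-board-≤ : ∀ {m n V} (v : ℕ → Cell) → (∀ i → i < V → OnBoard m n (v i)) →
  (∀ i j → i < V → j < V → v i ≡ v j → i ≡ j) → V ≤ m * n
injection-into-board-≤ {m} {n} {V} v on-board injective = Fin.injective⇒≤ {f = index} index-injective
  where
  index : Fin V → Fin (m * n)
  index i = combine (fromℕ< (proj₂ (on-board (toℕ i) (Fin.toℕ<n i)))) (fromℕ< (proj₁ (on-board (toℕ i) (Fin.toℕ<n i))))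
  index-injective : ∀ {i j} → index i ≡ index j → i ≡ j
  index-injective {i} {j} eq with Fin.combine-injective {m = m} {n = n} _ _ _ _ eq
  ... | y≡y' , x≡x' = Fin.toℕ-injective (injective (toℕ i) (toℕ j) (Fin.toℕ<n i) (Fin.toℕ<n j)
    (cong₂ _,_ (Fin.fromℕ<-injective (proj₁ (v (toℕ i))) (proj₁ (v (toℕ j))) _ _ x≡x')
               (Fin.fromℕ<-injective (proj₂ (v (toℕ i))) (proj₂ (v (toℕ j))) _ _ y≡y')))

ConnectedPseudosnake-size≤area : ∀ {p q m n V} → ConnectedPseudosnake p q m n V → V ≤ m * n
ConnectedPseudosnake-size≤area S = injection-into-board-≤ cell on-board injective
  where
  open ConnectedPseudosnake S

length-cartesianProduct : ∀ {A B : Set} (xs : List A) (ys : List B) →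
  length (cartesianProduct xs ys) ≡ length xs * length ys
length-cartesianProduct []       ys = refl
length-cartesianProduct (x ∷ xs) ys = begin
  length (map (x ,_) ys ++ cartesianProduct xs ys)      ≡⟨ length-++ (map (x ,_) ys) ⟩
  length (map (x ,_) ys) + length (cartesianProduct xs ys) ≡⟨ cong₂ _+_ (length-map (x ,_) ys) (length-cartesianProduct xs ys) ⟩
  length ys + length xs * length ys                     ∎
  where
  open ≡-Reasoning

Unique-map⁺ : ∀ {A B : Set} {f : A → B} {xs : List A} →
  (∀ {x y} → x ∈ xs → y ∈ xs → f x ≡ f y → x ≡ y) → Unique xs → Unique (map f xs)
Unique-map⁺ {xs = []}     _   []           = []
Unique-map⁺ {xs = x ∷ xs} inj (x∉xs ∷ u) =
  All.map⁺ (All.tabulate λ y∈xs fx≡fy → All.lookup x∉xs y∈xs (inj (here refl) (there y∈xs) fx≡fy))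
  ∷ Unique-map⁺ (λ x∈ y∈ → inj (there x∈) (there y∈)) u

record IsPseudosnakeList (p q : ℕ) (ℓ : List Cell) : Set where
  field
    unique   : Unique ℓ
    degree≤2 : ∀ {x a b c} → x ∈ ℓ → a ∈ ℓ → b ∈ ℓ → c ∈ ℓ → a ≢ b → b ≢ c → a ≢ c →
               Adj p q x a → Adj p q x b → Adj p q x c → ⊥

map-IsPseudosnakeList : ∀ {p q P Q ℓ} (Φ : Cell → Cell) →
  (∀ {x y} → x ∈ ℓ → y ∈ ℓ → Φ x ≡ Φ y → x ≡ y) →
  (∀ {x y} → x ∈ ℓ → y ∈ ℓ → Adj P Q (Φ x) (Φ y) → Adj p q x y) →
  IsPseudosnakeList p q ℓ → IsPseudosnakeList P Q (map Φ ℓ)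
map-IsPseudosnakeList Φ Φ-inj Φ-adj S = record
  { unique   = Unique-map⁺ Φ-inj unique
  ; degree≤2 = degree≤2′
  }
  where
  open IsPseudosnakeList S
  degree≤2′ : ∀ {x a b c} → x ∈ map Φ _ → a ∈ map Φ _ → b ∈ map Φ _ → c ∈ map Φ _ → a ≢ b → b ≢ c → a ≢ c →
              Adj _ _ x a → Adj _ _ x b → Adj _ _ x c → ⊥
  degree≤2′ x∈ a∈ b∈ c∈ a≢b b≢c a≢c xa xb xc
    with ∈-map⁻ Φ x∈ | ∈-map⁻ Φ a∈ | ∈-map⁻ Φ b∈ | ∈-map⁻ Φ c∈
  ... | _ , x′∈ , refl | _ , a′∈ , refl | _ , b′∈ , refl | _ , c′∈ , refl =
    degree≤2 x′∈ a′∈ b′∈ c′∈ (λ e → a≢b (cong Φ e)) (λ e → b≢c (cong Φ e)) (λ e → a≢c (cong Φ e))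
      (Φ-adj x′∈ a′∈ xa) (Φ-adj x′∈ b′∈ xb) (Φ-adj x′∈ c′∈ xc)

nth : List Cell → ℕ → Cell
nth []       _       = (0 , 0)
nth (x ∷ ℓ) zero    = x
nth (x ∷ ℓ) (suc i) = nth ℓ i

nth-∈ : ∀ ℓ i → i < length ℓ → nth ℓ i ∈ ℓ
nth-∈ (x ∷ ℓ) zero    _         = here refl
nth-∈ (x ∷ ℓ) (suc i) (s≤s i<) = there (nth-∈ ℓ i i<)

nth-distinct : ∀ ℓ → Unique ℓ → ∀ i j → i < j → j < length ℓ → nth ℓ i ≢ nth ℓ j
nth-distinct (x ∷ ℓ) (x∉ℓ ∷ _) zero    (suc j) _         (s≤s j<) = All.lookup x∉ℓ (nth-∈ ℓ j j<)
nth-distinct (x ∷ ℓ) (_ ∷ u)   (suc i) (suc j) (s≤s i<j) (s≤s j<) = nth-distinct ℓ u i j i<j j<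

IsPseudosnakeList⇒Pseudosnake : ∀ {p q N ℓ} → IsPseudosnakeList p q ℓ → All (OnBoard N N) ℓ →
  Pseudosnake p q N (length ℓ)
IsPseudosnakeList⇒Pseudosnake {ℓ = ℓ} S on-board =
  nth ℓ ,
  (λ i i< → All.lookup on-board (nth-∈ ℓ i i<)) ,
  (λ i j i<j j< → nth-distinct ℓ unique i j i<j j<) ,
  λ i a b c i< a< b< c< a<b b<c (ia , ib , ic) →
    degree≤2 (nth-∈ ℓ i i<) (nth-∈ ℓ a a<) (nth-∈ ℓ b b<) (nth-∈ ℓ c c<)
      (nth-distinct ℓ unique a b a<b b<) (nth-distinct ℓ unique b c b<c c<)
      (nth-distinct ℓ unique a c (ℕ.<-trans a<b b<c) c<) ia ib ic
  where
  open IsPseudosnakeList S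

u+q<w⇒q<∣u-w∣ : ∀ {q u w} → u + q < w → q < ∣ u - w ∣
u+q<w⇒q<∣u-w∣ {q} {u} {w} u+q<w = subst (q <_) (sym (ℕ.m≤n⇒∣m-n∣≡n∸m u≤w))
  (ℕ.+-cancelˡ-< u q (w ∸ u) (subst (u + q <_) (sym (ℕ.m+[n∸m]≡n u≤w)) u+q<w))
  where
  u≤w : u ≤ w
  u≤w = ℕ.m+n≤o⇒m≤o u (ℕ.<⇒≤ u+q<w)

lower-block-gap : ∀ {q B Z a b x x'} → B + q ≤ Z → x < B → a < b → a * Z + x + q < b * Z + x'
lower-block-gap {q} {B} {Z} {a} {b} {x} {x'} B+q≤Z x<B a<b = begin-strict
  a * Z + x + q      ≡⟨ ℕ.+-assoc (a * Z) x q ⟩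
  a * Z + (x + q)    <⟨ ℕ.+-monoʳ-< (a * Z) (ℕ.+-monoˡ-< q x<B) ⟩
  a * Z + (B + q)    ≤⟨ ℕ.+-monoʳ-≤ (a * Z) B+q≤Z ⟩
  a * Z + Z          ≡⟨ ℕ.+-comm (a * Z) Z ⟩
  suc a * Z          ≤⟨ ℕ.*-monoˡ-≤ Z a<b ⟩
  b * Z              ≤⟨ ℕ.m≤m+n (b * Z) x' ⟩
  b * Z + x'         ∎
  where
  open ℕ.≤-Reasoning

block-coordinate< : ∀ {B Z g T x} → B ≤ Z → x < B → g < T → g * Z + x < T * Z
block-coordinate< {B} {Z} {g} {T} {x} B≤Z x<B g<T = begin-strict
  g * Z + x    <⟨ ℕ.+-monoʳ-< (g * Z) (ℕ.<-≤-trans x<B B≤Z) ⟩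
  g * Z + Z    ≡⟨ ℕ.+-comm (g * Z) Z ⟩
  suc g * Z    ≤⟨ ℕ.*-monoˡ-≤ Z g<T ⟩
  T * Z        ∎
  where
  open ℕ.≤-Reasoning

separated-blocks : ∀ {q B Z a b x x'} → B + q ≤ Z → x < B → x' < B → a ≢ b → q < ∣ a * Z + x - b * Z + x' ∣
separated-blocks {a = a} {b} {x} {x'} B+q≤Z x<B x'<B a≢b with <-cmp a b
... | tri< a<b _ _ = u+q<w⇒q<∣u-w∣ (lower-block-gap B+q≤Z x<B a<b)
... | tri≈ _ a≡b _ = ⊥-elim (a≢b a≡b)
... | tri> _ _ b<a = subst (_ <_) (ℕ.∣-∣-comm (b * _ + x') (a * _ + x)) (u+q<w⇒q<∣u-w∣ (lower-block-gap B+q≤Z x'<B b<a))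

far⇒≢ : ∀ {q u w} → q < ∣ u - w ∣ → u ≢ w
far⇒≢ {u = u} far refl = ℕ.<⇒≢ (ℕ.≤-<-trans z≤n far) (sym (ℕ.∣n-n∣≡0 u))

module Copies {p q m n V : ℕ} (p≤q : p ≤ q) (S : ConnectedPseudosnake p q m n V)
              (X Y : ℕ) (n+q≤X : n + q ≤ X) (m+q≤Y : m + q ≤ Y) where

  open ConnectedPseudosnake S

  copy : (ℕ × ℕ) × ℕ → Cell
  copy ((a , b) , i) = (a * X + proj₁ (cell i) , b * Y + proj₂ (cell i))

  copies : List (ℕ × ℕ) → List Cell
  copies G = map copy (cartesianProduct G (upTo V))

  different-blocks-far : ∀ {a b a' b' i j} → i < V → j < V → (a , b) ≢ (a' , b') →
    (q < ∣ proj₁ (copy ((a , b) , i)) - proj₁ (copy ((a' , b') , j)) ∣) ⊎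
    (q < ∣ proj₂ (copy ((a , b) , i)) - proj₂ (copy ((a' , b') , j)) ∣)
  different-blocks-far {a} {b} {a'} {b'} {i} {j} i<V j<V g≢g' with a ≟ a' | b ≟ b'
  ... | no a≢a'   | _         = inj₁ (separated-blocks n+q≤X (proj₁ (on-board i i<V)) (proj₁ (on-board j j<V)) a≢a')
  ... | yes _     | no b≢b'   = inj₂ (separated-blocks m+q≤Y (proj₂ (on-board i i<V)) (proj₂ (on-board j j<V)) b≢b')
  ... | yes refl  | yes refl  = ⊥-elim (g≢g' refl)

  same-block : ∀ g g' {i j} → i < V → j < V → (copy (g , i) ≡ copy (g' , j)) ⊎ Adj p q (copy (g , i)) (copy (g' , j)) → g ≡ g'
  same-block g g' {i} {j} i<V j<V rel with ≡-dec _≟_ _≟_ g g'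
  ... | yes g≡g' = g≡g'
  ... | no g≢g' with different-blocks-far i<V j<V g≢g' | rel
  ...   | far | inj₂ adj  = ⊥-elim (far⇒¬Adj p≤q (copy (g , i)) (copy (g' , j)) far adj)
  ...   | inj₁ far | inj₁ e = ⊥-elim (far⇒≢ far (cong proj₁ e))
  ...   | inj₂ far | inj₁ e = ⊥-elim (far⇒≢ far (cong proj₂ e))

  Adj-within-block : ∀ g i j → Adj p q (copy (g , i)) (copy (g , j)) → Adj p q (cell i) (cell j)
  Adj-within-block (a , b) i j =
    Adj-translate⁻ (a * X) (b * Y) (proj₁ (cell i)) (proj₂ (cell i)) (proj₁ (cell j)) (proj₂ (cell j))

  copy-injective : ∀ {g g' i j} → i < V → j < V → copy (g , i) ≡ copy (g' , j) → (g , i) ≡ (g' , j)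
  copy-injective {a , b} {g'} {i} {j} i<V j<V e with same-block (a , b) g' i<V j<V (inj₁ e)
  ... | refl = cong ((a , b) ,_) (injective i j i<V j<V
    (cong₂ _,_ (ℕ.+-cancelˡ-≡ (a * X) _ _ (cong proj₁ e)) (ℕ.+-cancelˡ-≡ (b * Y) _ _ (cong proj₂ e))))

  ∈-copies⁻ : ∀ G {c} → c ∈ copies G → ∃ λ g → ∃ λ i → (g ∈ G) × (i < V) × (c ≡ copy (g , i))
  ∈-copies⁻ G c∈ with ∈-map⁻ copy c∈
  ... | (g , i) , gi∈ , refl with ∈-cartesianProduct⁻ G (upTo V) gi∈
  ...   | g∈G , i∈ = g , i , g∈G , ∈-upTo⁻ i∈ , refl

  copies-IsPseudosnakeList : ∀ {G} → Unique G → IsPseudosnakeList p q (copies G)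
  copies-IsPseudosnakeList {G} unique-G = record
    { unique   = Unique-map⁺ copy-injective′ (Unique.cartesianProduct⁺ unique-G (Unique.upTo⁺ V))
    ; degree≤2 = degree≤2′
    }
    where
    index<V : ∀ {g i} → (g , i) ∈ cartesianProduct G (upTo V) → i < V
    index<V gi∈ = ∈-upTo⁻ (proj₂ (∈-cartesianProduct⁻ G (upTo V) gi∈))
    copy-injective′ : ∀ {x y} → x ∈ cartesianProduct G (upTo V) → y ∈ cartesianProduct G (upTo V) → copy x ≡ copy y → x ≡ y
    copy-injective′ {_ , _} {_ , _} x∈ y∈ = copy-injective (index<V x∈) (index<V y∈)
    degree≤2′ : ∀ {x a b c} → x ∈ copies G → a ∈ copies G → b ∈ copies G → c ∈ copies G → a ≢ b → b ≢ c → a ≢ c →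
                Adj p q x a → Adj p q x b → Adj p q x c → ⊥
    degree≤2′ x∈ a∈ b∈ c∈ a≢b b≢c a≢c xa xb xc with ∈-copies⁻ G x∈ | ∈-copies⁻ G a∈ | ∈-copies⁻ G b∈ | ∈-copies⁻ G c∈
    ... | g , i , _ , i<V , refl | ga , ia , _ , ia<V , refl | gb , ib , _ , ib<V , refl | gc , ic , _ , ic<V , refl
      with same-block g ga i<V ia<V (inj₂ xa) | same-block g gb i<V ib<V (inj₂ xb) | same-block g gc i<V ic<V (inj₂ xc)
    ... | refl | refl | refl =
      degree≤2 i ia ib ic i<V ia<V ib<V ic<V (λ e → a≢b (cong (λ k → copy (g , k)) e))
        (λ e → b≢c (cong (λ k → copy (g , k)) e)) (λ e → a≢c (cong (λ k → copy (g , k)) e))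
        (Adj-within-block g i ia xa) (Adj-within-block g i ib xb) (Adj-within-block g i ic xc)

  length-copies : ∀ G → length (copies G) ≡ length G * V
  length-copies G = begin
    length (copies G)                                  ≡⟨ length-map copy (cartesianProduct G (upTo V)) ⟩
    length (cartesianProduct G (upTo V))               ≡⟨ length-cartesianProduct G (upTo V) ⟩
    length G * length (upTo V)                         ≡⟨ cong (length G *_) (length-upTo V) ⟩
    length G * V                                       ∎
    where
    open ≡-Reasoning

-- Copies of S on a tY × tX grid of blocks form a pseudosnake of t²YX · V cells in the square of side tYX,
-- so the τ-bound gives V ≤ (r − δ) · YX.
free-density-bound : ∀ {p q m n V} → p ≤ q → 1 ≤ m → 1 ≤ n → ConnectedPseudosnake p q m n V →
  ∀ r → TauBelow p q r → toℚ V ≤ℚ r *ℚ toℚ ((m + q) * (n + q))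
free-density-bound {p} {q} {m} {n} {V} p≤q 1≤m 1≤n S r (δ , 0<δ , N₀ , τ-bound) =
  ℚ.≤-trans (toℚ-*-cancelˡ-≤ c V (Y * X) (r -ℚ δ) 0<c cV≤) ([r-δ]*x≤r*x r δ (toℚ (Y * X)) {{toℚ-nonNeg (Y * X)}} 0<δ)
  where
  open ConnectedPseudosnake S
  X Y t N c : ℕ
  X = n + q
  Y = m + q
  t = suc N₀
  N = t * (Y * X)
  c = t * t * (Y * X)
  open Copies p≤q S X Y ℕ.≤-refl ℕ.≤-refl
  blocks : List (ℕ × ℕ)
  blocks = cartesianProduct (upTo (t * Y)) (upTo (t * X))
  1≤YX : 1 ≤ Y * X
  1≤YX = ℕ.*-mono-≤ {1} {Y} {1} {X} (ℕ.≤-trans 1≤m (ℕ.m≤m+n m q)) (ℕ.≤-trans 1≤n (ℕ.m≤m+n n q))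
  0<c : 0 < c
  0<c = ℕ.*-mono-≤ {1} {t * t} (s≤s z≤n) 1≤YX
  N₀≤N : N₀ ≤ N
  N₀≤N = ℕ.≤-trans (ℕ.n≤1+n N₀) (ℕ.≤-trans (ℕ.≤-reflexive (sym (ℕ.*-identityʳ t))) (ℕ.*-monoʳ-≤ t 1≤YX))
  blocks-on-board : ∀ {z} → z ∈ copies blocks → OnBoard N N z
  blocks-on-board z∈ with ∈-copies⁻ blocks z∈
  ... | (a , b) , i , ab∈ , i<V , refl with ∈-cartesianProduct⁻ (upTo (t * Y)) (upTo (t * X)) ab∈
  ...   | a∈ , b∈ =
    subst (a * X + proj₁ (cell i) <_) (ℕ.*-assoc t Y X)
      (block-coordinate< (ℕ.m≤m+n n q) (proj₁ (on-board i i<V)) (∈-upTo⁻ a∈)) ,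
    subst (b * Y + proj₂ (cell i) <_) (trans (ℕ.*-assoc t X Y) (cong (t *_) (ℕ.*-comm X Y)))
      (block-coordinate< (ℕ.m≤m+n m q) (proj₂ (on-board i i<V)) (∈-upTo⁻ b∈))
  filled-square : Pseudosnake p q N (length (copies blocks))
  filled-square = IsPseudosnakeList⇒Pseudosnake
    (copies-IsPseudosnakeList (Unique.cartesianProduct⁺ (Unique.upTo⁺ (t * Y)) (Unique.upTo⁺ (t * X))))
    (All.tabulate blocks-on-board)
  size : length (copies blocks) ≡ c * V
  size = begin
    length (copies blocks)                               ≡⟨ length-copies blocks ⟩
    length blocks * V                                    ≡⟨ cong (_* V) (length-cartesianProduct (upTo (t * Y)) (upTo (t * X))) ⟩
    length (upTo (t * Y)) * length (upTo (t * X)) * V    ≡⟨ cong₂ (λ a b → a * b * V) (length-upTo (t * Y)) (length-upTo (t * X)) ⟩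
    t * Y * (t * X) * V                                  ≡⟨ solve 4 (λ t y x v → t :* y :* (t :* x) :* v := t :* t :* (y :* x) :* v) refl t Y X V ⟩
    c * V                                                ∎
    where
    open ≡-Reasoning
    open ℕ-Solver.+-*-Solver
  area : N * N ≡ c * (Y * X)
  area = solve 3 (λ t y x → t :* (y :* x) :* (t :* (y :* x)) := t :* t :* (y :* x) :* (y :* x)) refl t Y X
    where
    open ℕ-Solver.+-*-Solver
  cV≤ : toℚ (c * V) ≤ℚ (r -ℚ δ) *ℚ toℚ (c * (Y * X))
  cV≤ = subst₂ (λ a b → toℚ a ≤ℚ (r -ℚ δ) *ℚ toℚ b) size area (τ-bound N N₀≤N _ filled-square)

infix 4 _≡₂_
_≡₂_ : ℕ → ℕ → Set
m ≡₂ n = m % 2 ≡ n % 2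

+-cancelʳ-≡₂ : ∀ a b c → a + c ≡₂ b + c → a ≡₂ b
+-cancelʳ-≡₂ a b c a+c≡₂b+c = begin
  a % 2                ≡⟨ [m+kn]%n≡m%n a c 2 ⟨
  (a + c * 2) % 2      ≡⟨ cong (_% 2) (double a) ⟩
  (a + c + c) % 2      ≡⟨ %-distribˡ-+ (a + c) c 2 ⟩
  (((a + c) % 2) + c % 2) % 2 ≡⟨ cong (λ z → (z + c % 2) % 2) a+c≡₂b+c ⟩
  (((b + c) % 2) + c % 2) % 2 ≡⟨ %-distribˡ-+ (b + c) c 2 ⟨
  (b + c + c) % 2      ≡⟨ cong (_% 2) (double b) ⟨
  (b + c * 2) % 2      ≡⟨ [m+kn]%n≡m%n b c 2 ⟩
  b % 2                ∎
  where
  open ≡-Reasoning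
  double : ∀ x → x + c * 2 ≡ x + c + c
  double x = solve 2 (λ x c → x :+ c :* con 2 := x :+ c :+ c) refl x c
    where
    open ℕ-Solver.+-*-Solver

+-cong-≡₂ : ∀ a a' b b' → a ≡₂ a' → b ≡₂ b' → a + b ≡₂ a' + b'
+-cong-≡₂ a a' b b' a≡₂a' b≡₂b' = begin
  (a + b) % 2              ≡⟨ %-distribˡ-+ a b 2 ⟩
  (a % 2 + b % 2) % 2      ≡⟨ cong₂ (λ u v → (u + v) % 2) a≡₂a' b≡₂b' ⟩
  (a' % 2 + b' % 2) % 2    ≡⟨ %-distribˡ-+ a' b' 2 ⟨
  (a' + b') % 2            ∎
  where
  open ≡-Reasoning

∣m-m+d∣≡₂m+[m+d] : ∀ m d → ∣ m - m + d ∣ ≡₂ m + (m + d)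
∣m-m+d∣≡₂m+[m+d] m d = begin
  ∣ m - m + d ∣ % 2     ≡⟨ cong (_% 2) (ℕ.∣m-m+n∣≡n m d) ⟩
  d % 2                 ≡⟨ [m+kn]%n≡m%n d m 2 ⟨
  (d + m * 2) % 2       ≡⟨ cong (_% 2) (solve 2 (λ m d → d :+ m :* con 2 := m :+ (m :+ d)) refl m d) ⟩
  (m + (m + d)) % 2     ∎
  where
  open ≡-Reasoning
  open ℕ-Solver.+-*-Solver

∣m-n∣≡₂m+n : ∀ m n → ∣ m - n ∣ ≡₂ m + n
∣m-n∣≡₂m+n m n with ℕ.≤-total m n
... | inj₁ m≤n = subst (λ z → ∣ m - z ∣ ≡₂ m + z) (ℕ.m+[n∸m]≡n m≤n) (∣m-m+d∣≡₂m+[m+d] m (n ∸ m))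
... | inj₂ n≤m = subst₂ (λ u v → u % 2 ≡ v % 2) (ℕ.∣-∣-comm n m) (ℕ.+-comm n m)
  (subst (λ z → ∣ n - z ∣ ≡₂ n + z) (ℕ.m+[n∸m]≡n n≤m) (∣m-m+d∣≡₂m+[m+d] n (m ∸ n)))

x+2k∸y≡₂x+y : ∀ x y k → y ≤ x + k * 2 → x + k * 2 ∸ y ≡₂ x + y
x+2k∸y≡₂x+y x y k y≤ = +-cancelʳ-≡₂ (x + k * 2 ∸ y) (x + y) y (begin
  (x + k * 2 ∸ y + y) % 2     ≡⟨ cong (_% 2) (ℕ.m∸n+n≡m y≤) ⟩
  (x + k * 2) % 2             ≡⟨ [m+kn]%n≡m%n x k 2 ⟩
  x % 2                       ≡⟨ [m+kn]%n≡m%n x y 2 ⟨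
  (x + y * 2) % 2             ≡⟨ cong (_% 2) (solve 2 (λ x y → x :+ y :* con 2 := x :+ y :+ y) refl x y) ⟩
  (x + y + y) % 2             ∎)
  where
  open ≡-Reasoning
  open ℕ-Solver.+-*-Solver

parity : Cell → ℕ
parity (x , y) = (x + y) % 2

Adj-parity : ∀ {p q} → (p + q) % 2 ≡ 0 → ∀ a b → Adj p q a b → parity a ≡ parity b
Adj-parity {p} {q} p+q-even (x₁ , y₁) (x₂ , y₂) adj =
  +-cancelʳ-≡₂ (x₁ + y₁) (x₂ + y₂) (x₂ + y₂) (trans sum-even (sym double-even))
  where
  open ℕ-Solver.+-*-Solver
  rearrange : x₁ + y₁ + (x₂ + y₂) ≡ (x₁ + x₂) + (y₁ + y₂)
  rearrange = solve 4 (λ a b c d → a :+ b :+ (c :+ d) := (a :+ c) :+ (b :+ d)) refl x₁ y₁ x₂ y₂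
  coordinate : ∀ u v d → ∣ u - v ∣ ≡ d → u + v ≡₂ d
  coordinate u v d e = trans (sym (∣m-n∣≡₂m+n u v)) (cong (_% 2) e)
  displacement-even : Adj p q (x₁ , y₁) (x₂ , y₂) → (x₁ + x₂) + (y₁ + y₂) ≡₂ 0
  displacement-even (inj₁ (dx , dy)) = trans (+-cong-≡₂ (x₁ + x₂) p (y₁ + y₂) q (coordinate x₁ x₂ p dx) (coordinate y₁ y₂ q dy)) p+q-even
  displacement-even (inj₂ (dx , dy)) = trans (+-cong-≡₂ (x₁ + x₂) q (y₁ + y₂) p (coordinate x₁ x₂ q dx) (coordinate y₁ y₂ p dy))
                                             (trans (cong (_% 2) (ℕ.+-comm q p)) p+q-even)
  sum-even : (x₁ + y₁ + (x₂ + y₂)) % 2 ≡ 0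
  sum-even = trans (cong (_% 2) rearrange) (displacement-even adj)
  double-even : (x₂ + y₂ + (x₂ + y₂)) % 2 ≡ 0
  double-even = trans (cong (_% 2) (solve 1 (λ s → s :+ s := con 0 :+ s :* con 2) refl (x₂ + y₂))) ([m+kn]%n≡m%n 0 (x₂ + y₂) 2)

walk-parity : ∀ {p q m n V} → (p + q) % 2 ≡ 0 → (S : ConnectedPseudosnake p q m n V) →
  ∀ i → i < V → parity (ConnectedPseudosnake.cell S i) ≡ parity (ConnectedPseudosnake.cell S 0)
walk-parity p+q-even S zero    _     = refl
walk-parity p+q-even S (suc i) i+1<V =
  trans (sym (Adj-parity p+q-even (cell i) (cell (suc i)) (walk i i+1<V))) (walk-parity p+q-even S i (ℕ.<-trans (ℕ.n<1+n i) i+1<V))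
  where
  open ConnectedPseudosnake S

module _ {p q : ℕ} (p≤q : p ≤ q) (p+q-even : (p + q) % 2 ≡ 0) where

  private
    q∸p+p*2≡p+q : q ∸ p + p * 2 ≡ p + q
    q∸p+p*2≡p+q = begin
      q ∸ p + p * 2       ≡⟨ solve 2 (λ d p → d :+ p :* con 2 := (d :+ p) :+ p) refl (q ∸ p) p ⟩
      (q ∸ p + p) + p     ≡⟨ cong (_+ p) (ℕ.m∸n+n≡m p≤q) ⟩
      q + p               ≡⟨ ℕ.+-comm q p ⟩
      p + q               ∎
      where
      open ≡-Reasoning
      open ℕ-Solver.+-*-Solver

  freeQ*2≡p+q : freeQ p q * 2 ≡ p + q
  freeQ*2≡p+q = m/n*n≡m (m%n≡0⇒n∣m (p + q) 2 p+q-even)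

  freeP*2≡q∸p : freeP p q * 2 ≡ q ∸ p
  freeP*2≡q∸p = m/n*n≡m (m%n≡0⇒n∣m (q ∸ p) 2
    (trans (sym ([m+kn]%n≡m%n (q ∸ p) p 2)) (trans (cong (_% 2) q∸p+p*2≡p+q) p+q-even)))

  freeP+p≡freeQ : freeP p q + p ≡ freeQ p q
  freeP+p≡freeQ = ℕ.*-cancelʳ-≡ (freeP p q + p) (freeQ p q) 2 (begin
    (freeP p q + p) * 2          ≡⟨ ℕ.*-distribʳ-+ 2 (freeP p q) p ⟩
    freeP p q * 2 + p * 2        ≡⟨ cong (_+ p * 2) freeP*2≡q∸p ⟩
    q ∸ p + p * 2                ≡⟨ q∸p+p*2≡p+q ⟩
    p + q                        ≡⟨ freeQ*2≡p+q ⟨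
    freeQ p q * 2                ∎)
    where
    open ≡-Reasoning

  freeP+freeQ≡q : freeP p q + freeQ p q ≡ q
  freeP+freeQ≡q = ℕ.*-cancelʳ-≡ (freeP p q + freeQ p q) q 2 (begin
    (freeP p q + freeQ p q) * 2      ≡⟨ ℕ.*-distribʳ-+ 2 (freeP p q) (freeQ p q) ⟩
    freeP p q * 2 + freeQ p q * 2    ≡⟨ cong₂ _+_ freeP*2≡q∸p freeQ*2≡p+q ⟩
    q ∸ p + (p + q)                  ≡⟨ ℕ.+-assoc (q ∸ p) p q ⟨
    q ∸ p + p + q                    ≡⟨ cong (_+ q) (ℕ.m∸n+n≡m p≤q) ⟩
    q + q                            ≡⟨ solve 1 (λ q → q :+ q := q :* con 2) refl q ⟩
    q * 2                            ∎)
    where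
    open ≡-Reasoning
    open ℕ-Solver.+-*-Solver

∣+m-+n∣≡∣m-n∣ : ∀ m n → ℤ.∣ + m ℤ.- + n ∣ ≡ ∣ m - n ∣
∣+m-+n∣≡∣m-n∣ m n = trans (cong ℤ.∣_∣ (ℤ.m-n≡m⊖n m n)) (∣m⊖n∣≡∣m-n∣ m n)
  where
  ∣m⊖n∣≡∣m-n∣ : ∀ m n → ℤ.∣ m ⊖ n ∣ ≡ ∣ m - n ∣
  ∣m⊖n∣≡∣m-n∣ m n with ℕ.≤-total m n
  ... | inj₁ m≤n = trans (ℤ.∣⊖∣-≤ m≤n) (sym (ℕ.m≤n⇒∣m-n∣≡n∸m m≤n))
  ... | inj₂ n≤m = trans (ℤ.∣m⊖n∣≡∣n⊖m∣ m n) (trans (ℤ.∣⊖∣-≤ n≤m) (sym (ℕ.m≤n⇒∣n-m∣≡n∸m n≤m)))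

∣i∣≡+n⇒i≡±n : ∀ i n → ℤ.∣ i ∣ ≡ n → (i ≡ + n) ⊎ (i ≡ ℤ.- + n)
∣i∣≡+n⇒i≡±n (+ k)    n e    = inj₁ (cong +_ e)
∣i∣≡+n⇒i≡±n -[1+ k ] _ refl = inj₂ refl

∣i±j∣ : ∀ i j m n → ℤ.∣ i ∣ ≡ m → ℤ.∣ j ∣ ≡ n →
  ((ℤ.∣ i ℤ.+ j ∣ ≡ m + n) × (ℤ.∣ i ℤ.- j ∣ ≡ ∣ m - n ∣)) ⊎
  ((ℤ.∣ i ℤ.+ j ∣ ≡ ∣ m - n ∣) × (ℤ.∣ i ℤ.- j ∣ ≡ m + n))
∣i±j∣ i j m n ∣i∣≡m ∣j∣≡n with ∣i∣≡+n⇒i≡±n i m ∣i∣≡m | ∣i∣≡+n⇒i≡±n j n ∣j∣≡n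
... | inj₁ refl | inj₁ refl = inj₁ (refl , ∣+m-+n∣≡∣m-n∣ m n)
... | inj₁ refl | inj₂ refl = inj₂ (∣+m-+n∣≡∣m-n∣ m n , cong (λ z → ℤ.∣ + m ℤ.+ z ∣) (ℤ.neg-involutive (+ n)))
... | inj₂ refl | inj₁ refl = inj₂ (trans (cong ℤ.∣_∣ (ℤ.+-comm (ℤ.- + m) (+ n))) (trans (∣+m-+n∣≡∣m-n∣ n m) (ℕ.∣-∣-comm n m)) ,
                                   trans (cong ℤ.∣_∣ (sym (ℤ.neg-distrib-+ (+ m) (+ n)))) (ℤ.∣-i∣≡∣i∣ (+ (m + n))))
... | inj₂ refl | inj₂ refl = inj₁ (trans (cong ℤ.∣_∣ (sym (ℤ.neg-distrib-+ (+ m) (+ n)))) (ℤ.∣-i∣≡∣i∣ (+ (m + n))) ,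
                                   trans (cong ℤ.∣_∣ (trans (cong (λ z → (ℤ.- + m) ℤ.+ z) (ℤ.neg-involutive (+ n))) (ℤ.+-comm (ℤ.- + m) (+ n))))
                                         (trans (∣+m-+n∣≡∣m-n∣ n m) (ℕ.∣-∣-comm n m)))

-- On one parity class of x + y this is injective and turns Free(L)-moves of the image into (p,q)-leaper
-- moves of the preimage; K₁ and K₂ only shift the image into ℕ².
rotate : ℕ → ℕ → Cell → Cell
rotate K₁ K₂ (x , y) = ((x + y ∸ K₁) / 2 , (x + K₂ ∸ y) / 2)

Rotatable : ℕ → ℕ → ℕ → Cell → Set
Rotatable K₁ K₂ e (x , y) = (K₁ ≤ x + y) × (y ≤ x + K₂) × ((x + y ∸ K₁) % 2 ≡ e) × ((x + K₂ ∸ y) % 2 ≡ e)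

halve-exact : ∀ K z e → K ≤ z → (z ∸ K) % 2 ≡ e → e + (z ∸ K) / 2 * 2 + K ≡ z
halve-exact K z e K≤z [z∸K]%2≡e = begin
  e + (z ∸ K) / 2 * 2 + K             ≡⟨ cong (λ r → r + (z ∸ K) / 2 * 2 + K) [z∸K]%2≡e ⟨
  (z ∸ K) % 2 + (z ∸ K) / 2 * 2 + K   ≡⟨ cong (_+ K) (m≡m%n+[m/n]*n (z ∸ K) 2) ⟨
  z ∸ K + K                           ≡⟨ ℕ.m∸n+n≡m K≤z ⟩
  z                                   ∎
  where
  open ≡-Reasoning

private
  cast : ∀ a b c d f → a + b * 2 + c ≡ d + f → + a ℤ.+ + b ℤ.* + 2 ℤ.+ + c ≡ + d ℤ.+ + f
  cast a b c d f eq = begin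
    + a ℤ.+ + b ℤ.* + 2 ℤ.+ + c    ≡⟨ cong (λ z → + a ℤ.+ z ℤ.+ + c) (ℤ.pos-* b 2) ⟨
    + a ℤ.+ + (b * 2) ℤ.+ + c      ≡⟨ cong (ℤ._+ + c) (ℤ.pos-+ a (b * 2)) ⟨
    + (a + b * 2) ℤ.+ + c          ≡⟨ ℤ.pos-+ (a + b * 2) c ⟨
    + (a + b * 2 + c)              ≡⟨ cong +_ eq ⟩
    + (d + f)                      ≡⟨ ℤ.pos-+ d f ⟩
    + d ℤ.+ + f                    ∎
    where
    open ≡-Reasoning

private
  ≡⇒-≡0 : ∀ {a b : ℤ} → a ≡ b → a ℤ.- b ≡ + 0
  ≡⇒-≡0 {a} refl = ℤ.+-inverseʳ a

  *2-cancel : ∀ (a b : ℤ) → a ℤ.* + 2 ℤ.- b ℤ.* + 2 ≡ + 0 → a ≡ b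
  *2-cancel a b eq = ℤ.*-cancelʳ-≡ a b (+ 2) (ℤ.i-j≡0⇒i≡j _ _ eq)

-- Each conclusion doubled is a linear combination of the four hypotheses, which the ring solver checks.
rotated-displacement : ∀ (e u₁ w₁ x₁ y₁ u₂ w₂ x₂ y₂ K₁ K₂ : ℤ) →
  e ℤ.+ u₁ ℤ.* + 2 ℤ.+ K₁ ≡ x₁ ℤ.+ y₁ → e ℤ.+ w₁ ℤ.* + 2 ℤ.+ y₁ ≡ x₁ ℤ.+ K₂ →
  e ℤ.+ u₂ ℤ.* + 2 ℤ.+ K₁ ≡ x₂ ℤ.+ y₂ → e ℤ.+ w₂ ℤ.* + 2 ℤ.+ y₂ ≡ x₂ ℤ.+ K₂ →
  (x₁ ℤ.- x₂ ≡ (u₁ ℤ.- u₂) ℤ.+ (w₁ ℤ.- w₂)) × (y₁ ℤ.- y₂ ≡ (u₁ ℤ.- u₂) ℤ.- (w₁ ℤ.- w₂))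
rotated-displacement e u₁ w₁ x₁ y₁ u₂ w₂ x₂ y₂ K₁ K₂ s₁ d₁ s₂ d₂ =
  *2-cancel _ _ (trans sum-identity (cong₂ ℤ._-_ (cong₂ ℤ._+_ (≡⇒-≡0 s₂) (≡⇒-≡0 d₂)) (cong₂ ℤ._+_ (≡⇒-≡0 s₁) (≡⇒-≡0 d₁)))) ,
  *2-cancel _ _ (trans difference-identity (cong₂ ℤ._-_ (cong₂ ℤ._-_ (≡⇒-≡0 s₂) (≡⇒-≡0 d₂)) (cong₂ ℤ._-_ (≡⇒-≡0 s₁) (≡⇒-≡0 d₁))))
  where
  open ℤ-Solver.+-*-Solver
  sum-identity : (x₁ ℤ.- x₂) ℤ.* + 2 ℤ.- ((u₁ ℤ.- u₂) ℤ.+ (w₁ ℤ.- w₂)) ℤ.* + 2 ≡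
    ((e ℤ.+ u₂ ℤ.* + 2 ℤ.+ K₁ ℤ.- (x₂ ℤ.+ y₂)) ℤ.+ (e ℤ.+ w₂ ℤ.* + 2 ℤ.+ y₂ ℤ.- (x₂ ℤ.+ K₂))) ℤ.-
    ((e ℤ.+ u₁ ℤ.* + 2 ℤ.+ K₁ ℤ.- (x₁ ℤ.+ y₁)) ℤ.+ (e ℤ.+ w₁ ℤ.* + 2 ℤ.+ y₁ ℤ.- (x₁ ℤ.+ K₂)))
  sum-identity = solve 11 (λ e u₁ w₁ x₁ y₁ u₂ w₂ x₂ y₂ K₁ K₂ →
    (x₁ :- x₂) :* con (+ 2) :- ((u₁ :- u₂) :+ (w₁ :- w₂)) :* con (+ 2) :=
    ((e :+ u₂ :* con (+ 2) :+ K₁ :- (x₂ :+ y₂)) :+ (e :+ w₂ :* con (+ 2) :+ y₂ :- (x₂ :+ K₂))) :-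
    ((e :+ u₁ :* con (+ 2) :+ K₁ :- (x₁ :+ y₁)) :+ (e :+ w₁ :* con (+ 2) :+ y₁ :- (x₁ :+ K₂))))
    refl e u₁ w₁ x₁ y₁ u₂ w₂ x₂ y₂ K₁ K₂
  difference-identity : (y₁ ℤ.- y₂) ℤ.* + 2 ℤ.- ((u₁ ℤ.- u₂) ℤ.- (w₁ ℤ.- w₂)) ℤ.* + 2 ≡
    ((e ℤ.+ u₂ ℤ.* + 2 ℤ.+ K₁ ℤ.- (x₂ ℤ.+ y₂)) ℤ.- (e ℤ.+ w₂ ℤ.* + 2 ℤ.+ y₂ ℤ.- (x₂ ℤ.+ K₂))) ℤ.-
    ((e ℤ.+ u₁ ℤ.* + 2 ℤ.+ K₁ ℤ.- (x₁ ℤ.+ y₁)) ℤ.- (e ℤ.+ w₁ ℤ.* + 2 ℤ.+ y₁ ℤ.- (x₁ ℤ.+ K₂)))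
  difference-identity = solve 11 (λ e u₁ w₁ x₁ y₁ u₂ w₂ x₂ y₂ K₁ K₂ →
    (y₁ :- y₂) :* con (+ 2) :- ((u₁ :- u₂) :- (w₁ :- w₂)) :* con (+ 2) :=
    ((e :+ u₂ :* con (+ 2) :+ K₁ :- (x₂ :+ y₂)) :- (e :+ w₂ :* con (+ 2) :+ y₂ :- (x₂ :+ K₂))) :-
    ((e :+ u₁ :* con (+ 2) :+ K₁ :- (x₁ :+ y₁)) :- (e :+ w₁ :* con (+ 2) :+ y₁ :- (x₁ :+ K₂))))
    refl e u₁ w₁ x₁ y₁ u₂ w₂ x₂ y₂ K₁ K₂

infixl 6 _⊖ᶜ_
_⊖ᶜ_ : Cell → Cell → ℤ × ℤ
(x₁ , y₁) ⊖ᶜ (x₂ , y₂) = (+ x₁ ℤ.- + x₂ , + y₁ ℤ.- + y₂)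

rotate-⊖ᶜ : ∀ {K₁ K₂ e} c₁ c₂ → Rotatable K₁ K₂ e c₁ → Rotatable K₁ K₂ e c₂ →
  c₁ ⊖ᶜ c₂ ≡ (proj₁ (rotate K₁ K₂ c₁ ⊖ᶜ rotate K₁ K₂ c₂) ℤ.+ proj₂ (rotate K₁ K₂ c₁ ⊖ᶜ rotate K₁ K₂ c₂) ,
              proj₁ (rotate K₁ K₂ c₁ ⊖ᶜ rotate K₁ K₂ c₂) ℤ.- proj₂ (rotate K₁ K₂ c₁ ⊖ᶜ rotate K₁ K₂ c₂))
rotate-⊖ᶜ {K₁} {K₂} {e} (x₁ , y₁) (x₂ , y₂) (s₁ , d₁ , ps₁ , pd₁) (s₂ , d₂ , ps₂ , pd₂) =
  let Δx , Δy = rotated-displacement (+ e) (+ u x₁ y₁) (+ w x₁ y₁) (+ x₁) (+ y₁) (+ u x₂ y₂) (+ w x₂ y₂) (+ x₂) (+ y₂) (+ K₁) (+ K₂)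
                  (cast e (u x₁ y₁) K₁ x₁ y₁ (halve-exact K₁ (x₁ + y₁) e s₁ ps₁)) (cast e (w x₁ y₁) y₁ x₁ K₂ (halve-exact y₁ (x₁ + K₂) e d₁ pd₁))
                  (cast e (u x₂ y₂) K₁ x₂ y₂ (halve-exact K₁ (x₂ + y₂) e s₂ ps₂)) (cast e (w x₂ y₂) y₂ x₂ K₂ (halve-exact y₂ (x₂ + K₂) e d₂ pd₂))
  in cong₂ _,_ Δx Δy
  where
  u w : ℕ → ℕ → ℕ
  u x y = (x + y ∸ K₁) / 2
  w x y = (x + K₂ ∸ y) / 2

⊖ᶜ-self : ∀ c → c ⊖ᶜ c ≡ (+ 0 , + 0)
⊖ᶜ-self (x , y) = cong₂ _,_ (ℤ.+-inverseʳ (+ x)) (ℤ.+-inverseʳ (+ y))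

⊖ᶜ≡0⇒≡ : ∀ c₁ c₂ → c₁ ⊖ᶜ c₂ ≡ (+ 0 , + 0) → c₁ ≡ c₂
⊖ᶜ≡0⇒≡ (x₁ , y₁) (x₂ , y₂) eq = cong₂ _,_
  (ℤ.+-injective (ℤ.i-j≡0⇒i≡j (+ x₁) (+ x₂) (cong proj₁ eq)))
  (ℤ.+-injective (ℤ.i-j≡0⇒i≡j (+ y₁) (+ y₂) (cong proj₂ eq)))

rotate-injective : ∀ {K₁ K₂ e} c₁ c₂ → Rotatable K₁ K₂ e c₁ → Rotatable K₁ K₂ e c₂ →
  rotate K₁ K₂ c₁ ≡ rotate K₁ K₂ c₂ → c₁ ≡ c₂
rotate-injective {K₁} {K₂} c₁ c₂ r₁ r₂ eq = ⊖ᶜ≡0⇒≡ c₁ c₂ (begin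
  c₁ ⊖ᶜ c₂                                    ≡⟨ rotate-⊖ᶜ c₁ c₂ r₁ r₂ ⟩
  (proj₁ Δ ℤ.+ proj₂ Δ , proj₁ Δ ℤ.- proj₂ Δ)  ≡⟨ cong (λ d → (proj₁ d ℤ.+ proj₂ d , proj₁ d ℤ.- proj₂ d)) Δ≡0 ⟩
  (+ 0 , + 0)                                 ∎)
  where
  open ≡-Reasoning
  Δ : ℤ × ℤ
  Δ = rotate K₁ K₂ c₁ ⊖ᶜ rotate K₁ K₂ c₂
  Δ≡0 : Δ ≡ (+ 0 , + 0)
  Δ≡0 = trans (cong (_⊖ᶜ rotate K₁ K₂ c₂) eq) (⊖ᶜ-self (rotate K₁ K₂ c₂))

AdjAt : ℕ → ℕ → ℤ × ℤ → Set
AdjAt p q (i , j) = ((ℤ.∣ i ∣ ≡ p) × (ℤ.∣ j ∣ ≡ q)) ⊎ ((ℤ.∣ i ∣ ≡ q) × (ℤ.∣ j ∣ ≡ p))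

Adj⇒AdjAt : ∀ {p q} c₁ c₂ → Adj p q c₁ c₂ → AdjAt p q (c₁ ⊖ᶜ c₂)
Adj⇒AdjAt (x₁ , y₁) (x₂ , y₂) (inj₁ (dx , dy)) = inj₁ (trans (∣+m-+n∣≡∣m-n∣ x₁ x₂) dx , trans (∣+m-+n∣≡∣m-n∣ y₁ y₂) dy)
Adj⇒AdjAt (x₁ , y₁) (x₂ , y₂) (inj₂ (dx , dy)) = inj₂ (trans (∣+m-+n∣≡∣m-n∣ x₁ x₂) dx , trans (∣+m-+n∣≡∣m-n∣ y₁ y₂) dy)

AdjAt⇒Adj : ∀ {p q} c₁ c₂ → AdjAt p q (c₁ ⊖ᶜ c₂) → Adj p q c₁ c₂
AdjAt⇒Adj (x₁ , y₁) (x₂ , y₂) (inj₁ (dx , dy)) = inj₁ (trans (sym (∣+m-+n∣≡∣m-n∣ x₁ x₂)) dx , trans (sym (∣+m-+n∣≡∣m-n∣ y₁ y₂)) dy)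
AdjAt⇒Adj (x₁ , y₁) (x₂ , y₂) (inj₂ (dx , dy)) = inj₂ (trans (sym (∣+m-+n∣≡∣m-n∣ x₁ x₂)) dx , trans (sym (∣+m-+n∣≡∣m-n∣ y₁ y₂)) dy)

private
  m+d≡n⇒∣m-n∣≡d : ∀ {m n d} → m + d ≡ n → ∣ m - n ∣ ≡ d
  m+d≡n⇒∣m-n∣≡d {m} {d = d} refl = ℕ.∣m-m+n∣≡n m d

  ∣i±j∣⇒AdjAt : ∀ i j a b {p q} → a + b ≡ q → ∣ a - b ∣ ≡ p →
    ((ℤ.∣ i ∣ ≡ a + b) × (ℤ.∣ j ∣ ≡ ∣ a - b ∣)) ⊎ ((ℤ.∣ i ∣ ≡ ∣ a - b ∣) × (ℤ.∣ j ∣ ≡ a + b)) → AdjAt p q (i , j)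
  ∣i±j∣⇒AdjAt _ _ _ _ refl refl (inj₁ (∣i∣ , ∣j∣)) = inj₂ (∣i∣ , ∣j∣)
  ∣i±j∣⇒AdjAt _ _ _ _ refl refl (inj₂ (∣i∣ , ∣j∣)) = inj₁ (∣i∣ , ∣j∣)

AdjAt-rotate : ∀ {P Q p q} → P + Q ≡ q → P + p ≡ Q → ∀ i j → AdjAt P Q (i , j) → AdjAt p q (i ℤ.+ j , i ℤ.- j)
AdjAt-rotate {P} {Q} P+Q≡q P+p≡Q i j (inj₁ (∣i∣ , ∣j∣)) =
  ∣i±j∣⇒AdjAt (i ℤ.+ j) (i ℤ.- j) P Q P+Q≡q (m+d≡n⇒∣m-n∣≡d P+p≡Q) (∣i±j∣ i j P Q ∣i∣ ∣j∣)
AdjAt-rotate {P} {Q} P+Q≡q P+p≡Q i j (inj₂ (∣i∣ , ∣j∣)) =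
  ∣i±j∣⇒AdjAt (i ℤ.+ j) (i ℤ.- j) Q P (trans (ℕ.+-comm Q P) P+Q≡q) (trans (ℕ.∣-∣-comm Q P) (m+d≡n⇒∣m-n∣≡d P+p≡Q))
    (∣i±j∣ i j Q P ∣i∣ ∣j∣)

rotate-reflects-Adj : ∀ {P Q p q K₁ K₂ e} → P + Q ≡ q → P + p ≡ Q → ∀ c₁ c₂ →
  Rotatable K₁ K₂ e c₁ → Rotatable K₁ K₂ e c₂ → Adj P Q (rotate K₁ K₂ c₁) (rotate K₁ K₂ c₂) → Adj p q c₁ c₂
rotate-reflects-Adj {K₁ = K₁} {K₂} P+Q≡q P+p≡Q c₁ c₂ r₁ r₂ adj =
  AdjAt⇒Adj c₁ c₂ (subst (AdjAt _ _) (sym (rotate-⊖ᶜ c₁ c₂ r₁ r₂))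
    (AdjAt-rotate P+Q≡q P+p≡Q (proj₁ Δ) (proj₂ Δ) (Adj⇒AdjAt (rotate K₁ K₂ c₁) (rotate K₁ K₂ c₂) adj)))
  where
  Δ : ℤ × ℤ
  Δ = rotate K₁ K₂ c₁ ⊖ᶜ rotate K₁ K₂ c₂

rotate-on-board : ∀ {K₁ K₂ N x y} → K₁ ≤ x + y → y ≤ x + K₂ →
  x + y < N * 2 + K₁ → x + K₂ < N * 2 + y → OnBoard N N (rotate K₁ K₂ (x , y))
rotate-on-board {K₁} {K₂} {N} {x} {y} K₁≤ y≤ sum< diff< = half< (x + y) K₁ K₁≤ sum< , half< (x + K₂) y y≤ diff<
  where
  half< : ∀ z K → K ≤ z → z < N * 2 + K → (z ∸ K) / 2 < N
  half< z K K≤z z< = m<n*o⇒m/o<n (subst (z ∸ K <_) (ℕ.m+n∸n≡m (N * 2) K) (ℕ.∸-monoˡ-< z< K≤z))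

private
  ≤-by : ∀ {a b} k → b ≡ a + k → a ≤ b
  ≤-by {a} k refl = ℕ.m≤m+n a k

  ∃-split : ∀ {j t'} → j ≤ t' → Σ ℕ λ s → t' ≡ j + s
  ∃-split {j} {t'} j≤t' = t' ∸ j , sym (ℕ.m+[n∸m]≡n j≤t')

-- Blocks with t' ≤ c + d ≤ 3t' and ∣c − d∣ ≤ t': a square turned by 45°, listed below as (t'+1)² blocks
-- with c + d ≡ t' and t'² blocks with c + d ≢ t' (mod 2), whose image under rotate fits a square of t'+1 blocks.
record InDiamond (t' c d : ℕ) : Set where
  field
    lower : t' ≤ c + d
    upper : c + d + 2 ≤ suc t' * 2 + t'
    left  : d + 1 ≤ c + suc t'
    right : c + 1 ≤ d + suc t'

even-block odd-block : ℕ → ℕ × ℕ → ℕ × ℕ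
even-block t' (i , j) = (i + j , i + (t' ∸ j))
odd-block  t' (i , j) = (suc (i + j) , i + (t' ∸ j))

even-block-InDiamond : ∀ t' i j → i ≤ t' → j ≤ t' → InDiamond t' (i + j) (i + (t' ∸ j))
even-block-InDiamond t' i j i≤t' j≤t' with ∃-split j≤t' | ∃-split i≤t'
... | s , refl | r , t'≡i+r rewrite ℕ.m+n∸m≡n j s = record
  { lower = ≤-by (i + i) (solve 3 (λ i j s → i :+ j :+ (i :+ s) := j :+ s :+ (i :+ i)) refl i j s)
  ; upper = ≤-by (r + r) (begin
      suc (j + s) * 2 + (j + s)            ≡⟨ solve 2 (λ j s → (con 1 :+ (j :+ s)) :* con 2 :+ (j :+ s) := (j :+ s) :+ (j :+ s) :+ (j :+ s) :+ con 2) refl j s ⟩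
      (j + s) + (j + s) + (j + s) + 2      ≡⟨ cong (λ T → T + T + (j + s) + 2) t'≡i+r ⟩
      (i + r) + (i + r) + (j + s) + 2      ≡⟨ solve 4 (λ i r j s → (i :+ r) :+ (i :+ r) :+ (j :+ s) :+ con 2 := i :+ j :+ (i :+ s) :+ con 2 :+ (r :+ r)) refl i r j s ⟩
      i + j + (i + s) + 2 + (r + r)        ∎)
  ; left  = ≤-by (j + j) (solve 3 (λ i j s → i :+ j :+ (con 1 :+ (j :+ s)) := i :+ s :+ con 1 :+ (j :+ j)) refl i j s)
  ; right = ≤-by (s + s) (solve 3 (λ i j s → i :+ s :+ (con 1 :+ (j :+ s)) := i :+ j :+ con 1 :+ (s :+ s)) refl i j s)
  }
  where
  open ≡-Reasoning
  open ℕ-Solver.+-*-Solver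

odd-block-InDiamond : ∀ t' i j → i < t' → j < t' → InDiamond t' (suc (i + j)) (i + (t' ∸ j))
odd-block-InDiamond t' i j i<t' j<t' with ∃-split j<t' | ∃-split i<t'
... | s , refl | r , t'≡1+i+r rewrite sym (ℕ.+-suc j s) | ℕ.m+n∸m≡n j (suc s) = record
  { lower = ≤-by (suc (i + i)) (solve 3 (λ i j s → con 1 :+ (i :+ j) :+ (i :+ (con 1 :+ s)) := j :+ (con 1 :+ s) :+ (con 1 :+ (i :+ i))) refl i j s)
  ; upper = ≤-by (suc (r + r)) (begin
      suc (j + suc s) * 2 + (j + suc s)         ≡⟨ solve 2 (λ j s → (con 1 :+ (j :+ (con 1 :+ s))) :* con 2 :+ (j :+ (con 1 :+ s))
                                                         := (j :+ (con 1 :+ s)) :+ (j :+ (con 1 :+ s)) :+ (j :+ s) :+ con 3) refl j s ⟩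
      (j + suc s) + (j + suc s) + (j + s) + 3   ≡⟨ cong (λ T → T + T + (j + s) + 3) t'≡1+i+r ⟩
      suc (i + r) + suc (i + r) + (j + s) + 3   ≡⟨ solve 4 (λ i r j s → (con 1 :+ (i :+ r)) :+ (con 1 :+ (i :+ r)) :+ (j :+ s) :+ con 3
                                                         := con 1 :+ (i :+ j) :+ (i :+ (con 1 :+ s)) :+ con 2 :+ (con 1 :+ (r :+ r))) refl i r j s ⟩
      suc (i + j) + (i + suc s) + 2 + suc (r + r) ∎)
  ; left  = ≤-by (suc (j + j)) (solve 3 (λ i j s → con 1 :+ (i :+ j) :+ (con 1 :+ (j :+ (con 1 :+ s)))
                                                   := i :+ (con 1 :+ s) :+ con 1 :+ (con 1 :+ (j :+ j))) refl i j s)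
  ; right = ≤-by (suc (s + s)) (solve 3 (λ i j s → i :+ (con 1 :+ s) :+ (con 1 :+ (j :+ (con 1 :+ s)))
                                                   := con 1 :+ (i :+ j) :+ con 1 :+ (con 1 :+ (s :+ s))) refl i j s)
  }
  where
  open ≡-Reasoning
  open ℕ-Solver.+-*-Solver

square : ℕ → List (ℕ × ℕ)
square n = cartesianProduct (upTo n) (upTo n)

diamond : ℕ → List (ℕ × ℕ)
diamond t' = map (even-block t') (square (suc t'))
          ++ map (odd-block t') (square t')

∈-diamond⇒InDiamond : ∀ t' {c d} → (c , d) ∈ diamond t' → InDiamond t' c d
∈-diamond⇒InDiamond t' cd∈ with ∈-++⁻ (map (even-block t') (square (suc t'))) cd∈
... | inj₁ even∈ with ∈-map⁻ (even-block t') {xs = square (suc t')} even∈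
...   | (i , j) , ij∈ , refl with ∈-cartesianProduct⁻ (upTo (suc t')) (upTo (suc t')) ij∈
...     | i∈ , j∈ = even-block-InDiamond t' i j (ℕ.≤-pred (∈-upTo⁻ i∈)) (ℕ.≤-pred (∈-upTo⁻ j∈))
∈-diamond⇒InDiamond t' cd∈ | inj₂ odd∈ with ∈-map⁻ (odd-block t') {xs = square t'} odd∈
...   | (i , j) , ij∈ , refl with ∈-cartesianProduct⁻ (upTo t') (upTo t') ij∈
...     | i∈ , j∈ = odd-block-InDiamond t' i j (∈-upTo⁻ i∈) (∈-upTo⁻ j∈)

private
  diagonal-sum : ∀ {t' j} i → j ≤ t' → (i + j) + (i + (t' ∸ j)) ≡ i * 2 + t'
  diagonal-sum {t'} {j} i j≤t' with ∃-split j≤t'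
  ... | s , refl rewrite ℕ.m+n∸m≡n j s = solve 3 (λ i j s → i :+ j :+ (i :+ s) := i :* con 2 :+ (j :+ s)) refl i j s
    where
    open ℕ-Solver.+-*-Solver

  block-injective : ∀ {t' i j i' j'} → j ≤ t' → j' ≤ t' →
    i + j ≡ i' + j' → i + (t' ∸ j) ≡ i' + (t' ∸ j') → (i , j) ≡ (i' , j')
  block-injective {t'} {i} {j} {i'} {j'} j≤t' j'≤t' c≡c' d≡d' = cong₂ _,_ i≡i' (ℕ.+-cancelˡ-≡ i j j' (trans c≡c' (cong (_+ j') (sym i≡i'))))
    where
    i≡i' : i ≡ i'
    i≡i' = ℕ.*-cancelʳ-≡ i i' 2 (ℕ.+-cancelʳ-≡ t' (i * 2) (i' * 2)
      (trans (sym (diagonal-sum i j≤t')) (trans (cong₂ _+_ c≡c' d≡d') (diagonal-sum i' j'≤t'))))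

  1+2a≢2b : ∀ a b → suc (a * 2) ≢ b * 2
  1+2a≢2b a b eq with trans (sym ([m+kn]%n≡m%n 1 a 2)) (trans (cong (_% 2) eq) ([m+kn]%n≡m%n 0 b 2))
  ... | ()

  ∈-square⇒snd< : ∀ {n} {ij : ℕ × ℕ} → ij ∈ cartesianProduct (upTo n) (upTo n) → proj₂ ij < n
  ∈-square⇒snd< {n} ij∈ = ∈-upTo⁻ (proj₂ (∈-cartesianProduct⁻ (upTo n) (upTo n) ij∈))

diamond-unique : ∀ t' → Unique (diamond t')
diamond-unique t' = Unique.++⁺
  (Unique-map⁺ (λ {(_ , _)} {(_ , _)} ij∈ ij'∈ eq →
      block-injective (ℕ.≤-pred (∈-square⇒snd< ij∈)) (ℕ.≤-pred (∈-square⇒snd< ij'∈)) (cong proj₁ eq) (cong proj₂ eq))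
    (Unique.cartesianProduct⁺ (Unique.upTo⁺ (suc t')) (Unique.upTo⁺ (suc t'))))
  (Unique-map⁺ (λ {(_ , _)} {(_ , _)} ij∈ ij'∈ eq →
      block-injective (ℕ.<⇒≤ (∈-square⇒snd< ij∈)) (ℕ.<⇒≤ (∈-square⇒snd< ij'∈)) (ℕ.suc-injective (cong proj₁ eq)) (cong proj₂ eq))
    (Unique.cartesianProduct⁺ (Unique.upTo⁺ t') (Unique.upTo⁺ t')))
  even≢odd
  where
  open ≡-Reasoning
  even≢odd : ∀ {g} → g ∈ map (even-block t') (square (suc t')) ×
                     g ∈ map (odd-block t') (square t') → ⊥
  even≢odd (even∈ , odd∈) with ∈-map⁻ (even-block t') {xs = square (suc t')} even∈ | ∈-map⁻ (odd-block t') {xs = square t'} odd∈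
  ... | (i , j) , ij∈ , refl | (i' , j') , ij'∈ , eq =
    1+2a≢2b i' i (ℕ.+-cancelʳ-≡ t' _ _ (sym (begin
      i * 2 + t'                             ≡⟨ diagonal-sum i (ℕ.≤-pred (∈-square⇒snd< ij∈)) ⟨
      (i + j) + (i + (t' ∸ j))               ≡⟨ cong (λ g → proj₁ g + proj₂ g) eq ⟩
      suc (i' + j') + (i' + (t' ∸ j'))       ≡⟨ cong suc (diagonal-sum i' (ℕ.<⇒≤ (∈-square⇒snd< ij'∈))) ⟩
      suc (i' * 2 + t')                      ∎)))

length-diamond : ∀ t' → length (diamond t') ≡ suc t' * suc t' + t' * t'
length-diamond t' = begin
  length (diamond t')                                      ≡⟨ length-++ (map (even-block t') (square (suc t'))) ⟩
  length (map (even-block t') (square (suc t'))) + length (map (odd-block t') (square t'))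
                                                           ≡⟨ cong₂ _+_ (length-map (even-block t') (square (suc t'))) (length-map (odd-block t') (square t')) ⟩
  length (square (suc t')) + length (square t')            ≡⟨ cong₂ _+_ (length-square (suc t')) (length-square t') ⟩
  suc t' * suc t' + t' * t'                                ∎
  where
  open ≡-Reasoning
  length-square : ∀ n → length (square n) ≡ n * n
  length-square n = trans (length-cartesianProduct (upTo n) (upTo n)) (cong₂ _*_ (length-upTo n) (length-upTo n))

round-up-even : ∀ z → (z ≤ (z + 1) / 2 * 2) × ((z + 1) / 2 * 2 ≤ z + 1)
round-up-even z = ℕ.≤-pred (begin
  suc z                               ≡⟨ ℕ.+-comm 1 z ⟩
  z + 1                               ≡⟨ m≡m%n+[m/n]*n (z + 1) 2 ⟩
  (z + 1) % 2 + (z + 1) / 2 * 2       ≤⟨ ℕ.+-monoˡ-≤ ((z + 1) / 2 * 2) (ℕ.≤-pred (m%n<n (z + 1) 2)) ⟩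
  suc ((z + 1) / 2 * 2)               ∎) ,
  m/n*n≤m (z + 1) 2
  where
  open ℕ.≤-Reasoning

mixed-radix-injective : ∀ {Y} c c' {i i'} → i < Y → i' < Y → c * Y + i ≡ c' * Y + i' → (c ≡ c') × (i ≡ i')
mixed-radix-injective {Y} c c' {i} {i'} i<Y i'<Y eq with <-cmp c c'
... | tri< c<c' _ _ = ⊥-elim (ℕ.<-irrefl eq (ℕ.<-≤-trans (block-coordinate< ℕ.≤-refl i<Y c<c') (ℕ.m≤m+n (c' * Y) i')))
... | tri≈ _ refl _ = refl , ℕ.+-cancelˡ-≡ (c * Y) i i' eq
... | tri> _ _ c'<c = ⊥-elim (ℕ.<-irrefl (sym eq) (ℕ.<-≤-trans (block-coordinate< ℕ.≤-refl i'<Y c'<c) (ℕ.m≤m+n (c * Y) i)))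

sub-block : ℕ → ℕ → (ℕ × ℕ) × (ℕ × ℕ) → ℕ × ℕ
sub-block Y X ((c , d) , (i , j)) = (c * Y + i , d * X + j)

blow-up : ℕ → ℕ → List (ℕ × ℕ) → List (ℕ × ℕ)
blow-up Y X G = map (sub-block Y X) (cartesianProduct G (cartesianProduct (upTo Y) (upTo X)))

module _ {Y X : ℕ} {G : List (ℕ × ℕ)} where

  private
    offsets : List (ℕ × ℕ)
    offsets = cartesianProduct (upTo Y) (upTo X)

    offset< : ∀ {g i j} → (g , (i , j)) ∈ cartesianProduct G offsets → (i < Y) × (j < X)
    offset< {g} {i} {j} gij∈ with ∈-cartesianProduct⁻ (upTo Y) (upTo X) (proj₂ (∈-cartesianProduct⁻ G offsets gij∈))
    ... | i∈ , j∈ = ∈-upTo⁻ i∈ , ∈-upTo⁻ j∈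

  ∈-blow-up⁻ : ∀ {g} → g ∈ blow-up Y X G →
    ∃₂ λ cd ij → (cd ∈ G) × (proj₁ ij < Y) × (proj₂ ij < X) × (g ≡ sub-block Y X (cd , ij))
  ∈-blow-up⁻ g∈ with ∈-map⁻ (sub-block Y X) {xs = cartesianProduct G offsets} g∈
  ... | (cd , (i , j)) , cdij∈ , refl =
    cd , (i , j) , proj₁ (∈-cartesianProduct⁻ G offsets cdij∈) , proj₁ (offset< cdij∈) , proj₂ (offset< cdij∈) , refl

  blow-up-unique : Unique G → Unique (blow-up Y X G)
  blow-up-unique unique-G = Unique-map⁺ injective
    (Unique.cartesianProduct⁺ unique-G (Unique.cartesianProduct⁺ (Unique.upTo⁺ Y) (Unique.upTo⁺ X)))
    where
    injective : ∀ {a b} → a ∈ cartesianProduct G offsets → b ∈ cartesianProduct G offsets → sub-block Y X a ≡ sub-block Y X b → a ≡ b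
    injective {(c , d) , (i , j)} {(c' , d') , (i' , j')} a∈ b∈ eq
      with mixed-radix-injective c c' (proj₁ (offset< a∈)) (proj₁ (offset< b∈)) (cong proj₁ eq)
         | mixed-radix-injective d d' (proj₂ (offset< a∈)) (proj₂ (offset< b∈)) (cong proj₂ eq)
    ... | refl , refl | refl , refl = refl

  length-blow-up : length (blow-up Y X G) ≡ length G * (Y * X)
  length-blow-up = begin
    length (blow-up Y X G)                          ≡⟨ length-map (sub-block Y X) (cartesianProduct G offsets) ⟩
    length (cartesianProduct G offsets)             ≡⟨ length-cartesianProduct G offsets ⟩
    length G * length offsets                       ≡⟨ cong (length G *_) (length-cartesianProduct (upTo Y) (upTo X)) ⟩
    length G * (length (upTo Y) * length (upTo X))  ≡⟨ cong₂ (λ a b → length G * (a * b)) (length-upTo Y) (length-upTo X) ⟩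
    length G * (Y * X)                              ∎
    where
    open ≡-Reasoning

module _ {t' A c d x₀ y₀ : ℕ} (in-diamond : InDiamond t' c d) (x₀<A : x₀ < A) (y₀<A : y₀ < A) where

  open InDiamond in-diamond
  open ℕ.≤-Reasoning
  private
    x y t : ℕ
    x = c * A + x₀
    y = d * A + y₀
    t = suc t'
    *A-mono : ∀ {a b} → a ≤ b → a * A ≤ b * A
    *A-mono = ℕ.*-monoˡ-≤ A
    <next : ∀ k {z} → z < A → k * A + z < k * A + A
    <next k z<A = ℕ.+-monoʳ-< (k * A) z<A

  diamond-point-lower : t' * A ≤ x + y
  diamond-point-lower = begin
    t' * A            ≤⟨ *A-mono lower ⟩
    (c + d) * A       ≡⟨ ℕ.*-distribʳ-+ A c d ⟩
    c * A + d * A     ≤⟨ ℕ.+-mono-≤ (ℕ.m≤m+n (c * A) x₀) (ℕ.m≤m+n (d * A) y₀) ⟩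
    x + y             ∎

  diamond-point-left : y ≤ x + t * A
  diamond-point-left = ℕ.<⇒≤ (begin-strict
    d * A + y₀        <⟨ <next d y₀<A ⟩
    d * A + A         ≡⟨ solve 2 (λ d A → d :* A :+ A := (d :+ con 1) :* A) refl d A ⟩
    (d + 1) * A       ≤⟨ *A-mono left ⟩
    (c + t) * A       ≡⟨ ℕ.*-distribʳ-+ A c t ⟩
    c * A + t * A     ≤⟨ ℕ.+-monoˡ-≤ (t * A) (ℕ.m≤m+n (c * A) x₀) ⟩
    x + t * A         ∎)
    where
    open ℕ-Solver.+-*-Solver

  diamond-point-upper : x + y < t * A * 2 + t' * A
  diamond-point-upper = begin-strict
    x + y                        <⟨ ℕ.+-mono-< (<next c x₀<A) (<next d y₀<A) ⟩
    (c * A + A) + (d * A + A)    ≡⟨ solve 3 (λ c d A → (c :* A :+ A) :+ (d :* A :+ A) := (c :+ d :+ con 2) :* A) refl c d A ⟩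
    (c + d + 2) * A              ≤⟨ *A-mono upper ⟩
    (t * 2 + t') * A             ≡⟨ solve 3 (λ t t' A → (t :* con 2 :+ t') :* A := t :* A :* con 2 :+ t' :* A) refl t t' A ⟩
    t * A * 2 + t' * A           ∎
    where
    open ℕ-Solver.+-*-Solver

  diamond-point-right : x + t * A < t * A * 2 + y
  diamond-point-right = begin-strict
    x + t * A                    <⟨ ℕ.+-monoˡ-< (t * A) (<next c x₀<A) ⟩
    c * A + A + t * A            ≡⟨ solve 3 (λ c t A → c :* A :+ A :+ t :* A := (c :+ con 1) :* A :+ t :* A) refl c t A ⟩
    (c + 1) * A + t * A          ≤⟨ ℕ.+-monoˡ-≤ (t * A) (*A-mono right) ⟩
    (d + t) * A + t * A          ≡⟨ solve 3 (λ d t A → (d :+ t) :* A :+ t :* A := t :* A :* con 2 :+ d :* A) refl d t A ⟩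
    t * A * 2 + d * A            ≤⟨ ℕ.+-monoʳ-≤ (t * A * 2) (ℕ.m≤m+n (d * A) y₀) ⟩
    t * A * 2 + y                ∎
    where
    open ℕ-Solver.+-*-Solver

module HalfFreeSquare {p q m n V : ℕ} (p<q : p < q) (p+q-even : (p + q) % 2 ≡ 0)
                      (S : ConnectedPseudosnake p q m n V) (t' : ℕ) where

  open ConnectedPseudosnake S

  -- X and Y are even, so translating copies by multiples of them keeps the parity of x + y.
  t α β X Y A K N : ℕ
  t = suc t'
  α = (n + q + 1) / 2
  β = (m + q + 1) / 2
  X = α * 2
  Y = β * 2
  A = Y * X
  K = t' * A
  N = t * A

  open Copies (ℕ.<⇒≤ p<q) S X Y (proj₁ (round-up-even (n + q))) (proj₁ (round-up-even (m + q)))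

  cells : List Cell
  cells = copies (blow-up Y X (diamond t'))
  e₀ : ℕ
  e₀ = parity (cell 0)

  copy-parity : ∀ gx gy i → parity (copy ((gx , gy) , i)) ≡ parity (cell i)
  copy-parity gx gy i = begin
    (gx * X + proj₁ (cell i) + (gy * Y + proj₂ (cell i))) % 2        ≡⟨ cong (_% 2) (solve 6 (λ gx gy α β x y →
         gx :* (α :* con 2) :+ x :+ (gy :* (β :* con 2) :+ y) := x :+ y :+ (gx :* α :+ gy :* β) :* con 2) refl gx gy α β (proj₁ (cell i)) (proj₂ (cell i))) ⟩
    (proj₁ (cell i) + proj₂ (cell i) + (gx * α + gy * β) * 2) % 2    ≡⟨ [m+kn]%n≡m%n (proj₁ (cell i) + proj₂ (cell i)) (gx * α + gy * β) 2 ⟩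
    parity (cell i)                                                  ∎
    where
    open ≡-Reasoning
    open ℕ-Solver.+-*-Solver

  point-facts : ∀ {c d x₀ y₀} → InDiamond t' c d → x₀ < A → y₀ < A → parity (c * A + x₀ , d * A + y₀) ≡ e₀ →
    Rotatable K N e₀ (c * A + x₀ , d * A + y₀) × OnBoard N N (rotate K N (c * A + x₀ , d * A + y₀))
  point-facts {c} {d} {x₀} {y₀} in-diamond x₀<A y₀<A parity≡e₀ =
    (lower , left , trans sum-parity parity≡e₀ , trans diff-parity parity≡e₀) ,
    rotate-on-board {K} {N} {N} {x} {y} lower left (diamond-point-upper in-diamond x₀<A y₀<A) (diamond-point-right in-diamond x₀<A y₀<A)
    where
    open ℕ-Solver.+-*-Solver
    x y : ℕ
    x = c * A + x₀
    y = d * A + y₀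
    lower : K ≤ x + y
    lower = diamond-point-lower in-diamond x₀<A y₀<A
    left : y ≤ x + N
    left = diamond-point-left in-diamond x₀<A y₀<A
    K≡ : K ≡ t' * Y * α * 2
    K≡ = solve 3 (λ t' β α → t' :* (β :* con 2 :* (α :* con 2)) := t' :* (β :* con 2) :* α :* con 2) refl t' β α
    N≡ : N ≡ t * Y * α * 2
    N≡ = solve 3 (λ t β α → t :* (β :* con 2 :* (α :* con 2)) := t :* (β :* con 2) :* α :* con 2) refl t β α
    sum-parity : (x + y ∸ K) % 2 ≡ (x + y) % 2
    sum-parity rewrite K≡ = m*n≤o⇒[o∸m*n]%n≡o%n (t' * Y * α) (subst (_≤ x + y) K≡ lower)
    diff-parity : (x + N ∸ y) % 2 ≡ (x + y) % 2
    diff-parity rewrite N≡ = x+2k∸y≡₂x+y x y (t * Y * α) (subst (λ k → y ≤ x + k) N≡ left)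

  cell-facts : ∀ {z} → z ∈ cells → Rotatable K N e₀ z × OnBoard N N (rotate K N z)
  cell-facts z∈ with ∈-copies⁻ (blow-up Y X (diamond t')) z∈
  ... | _ , i , g∈ , i<V , refl with ∈-blow-up⁻ {Y} {X} {diamond t'} g∈
  ...   | (c , d) , (i₁ , j₁) , cd∈ , i₁<Y , j₁<X , refl =
    subst (λ z → Rotatable K N e₀ z × OnBoard N N (rotate K N z)) (sym decompose)
      (point-facts (∈-diamond⇒InDiamond t' cd∈) x₀<A y₀<A
        (trans (cong parity (sym decompose)) (trans (copy-parity (c * Y + i₁) (d * X + j₁) i) (walk-parity p+q-even S i i<V))))
    where
    open ℕ-Solver.+-*-Solver
    x₀ = i₁ * X + proj₁ (cell i)
    y₀ = j₁ * Y + proj₂ (cell i)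
    decompose : copy ((c * Y + i₁ , d * X + j₁) , i) ≡ (c * A + x₀ , d * A + y₀)
    decompose = cong₂ _,_
      (solve 5 (λ c Y i₁ X x → (c :* Y :+ i₁) :* X :+ x := c :* (Y :* X) :+ (i₁ :* X :+ x)) refl c Y i₁ X (proj₁ (cell i)))
      (solve 5 (λ d Y j₁ X y → (d :* X :+ j₁) :* Y :+ y := d :* (Y :* X) :+ (j₁ :* Y :+ y)) refl d Y j₁ X (proj₂ (cell i)))
    x₀<A : x₀ < A
    x₀<A = block-coordinate< (ℕ.≤-trans (ℕ.m≤m+n n q) (proj₁ (round-up-even (n + q)))) (proj₁ (on-board i i<V)) i₁<Y
    y₀<A : y₀ < A
    y₀<A = subst (y₀ <_) (ℕ.*-comm X Y)
      (block-coordinate< (ℕ.≤-trans (ℕ.m≤m+n m q) (proj₁ (round-up-even (m + q)))) (proj₂ (on-board i i<V)) j₁<X)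

  rotated-cells : IsPseudosnakeList (freeP p q) (freeQ p q) (map (rotate K N) cells)
  rotated-cells = map-IsPseudosnakeList (rotate K N)
    (λ z∈ z'∈ → rotate-injective _ _ (proj₁ (cell-facts z∈)) (proj₁ (cell-facts z'∈)))
    (λ z∈ z'∈ → rotate-reflects-Adj (freeP+freeQ≡q (ℕ.<⇒≤ p<q) p+q-even) (freeP+p≡freeQ (ℕ.<⇒≤ p<q) p+q-even) _ _
                  (proj₁ (cell-facts z∈)) (proj₁ (cell-facts z'∈)))
    (copies-IsPseudosnakeList {blow-up Y X (diamond t')} (blow-up-unique {Y} {X} {diamond t'} (diamond-unique t')))

  size : length (map (rotate K N) cells) ≡ (t * t + t' * t') * (A * V)
  size = begin
    length (map (rotate K N) cells)                    ≡⟨ length-map (rotate K N) cells ⟩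
    length cells                                       ≡⟨ length-copies (blow-up Y X (diamond t')) ⟩
    length (blow-up Y X (diamond t')) * V              ≡⟨ cong (_* V) (length-blow-up {Y} {X} {diamond t'}) ⟩
    length (diamond t') * A * V                        ≡⟨ cong (λ l → l * A * V) (length-diamond t') ⟩
    (t * t + t' * t') * A * V                          ≡⟨ ℕ.*-assoc (t * t + t' * t') A V ⟩
    (t * t + t' * t') * (A * V)                        ∎
    where
    open ≡-Reasoning

  rotated-square : Pseudosnake (freeP p q) (freeQ p q) N ((t * t + t' * t') * (A * V))
  rotated-square = subst (Pseudosnake (freeP p q) (freeQ p q) N) size
    (IsPseudosnakeList⇒Pseudosnake rotated-cells (All.map⁺ (All.tabulate (λ z∈ → proj₂ (cell-facts z∈)))))

half-free-density-bound : ∀ {p q m n V} → p < q → (p + q) % 2 ≡ 0 → 1 ≤ m → 1 ≤ n → ConnectedPseudosnake p q m n V →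
  ∀ r → TauBelow (freeP p q) (freeQ p q) r →
  Σ ℕ λ D → (D ≤ (m + suc q) * (n + suc q)) × (toℚ V ≤ℚ (r *ℚ ½) *ℚ toℚ D)
half-free-density-bound {p} {q} {m} {n} {V} p<q p+q-even 1≤m 1≤n S r (δ , 0<δ , N₀ , τ-bound) =
  A , ℕ.*-mono-≤ (rounded≤ m) (rounded≤ n) ,
  halve-density r δ t' V A 1≤t' 1≤A r≤δt count≤
  where
  -- Projections rather than `with`: abstracting over a goal that contains toℚ makes Agda normalise it.
  scale : Σ ℕ λ t' → (suc N₀ ≤ t') × (r ≤ℚ δ *ℚ toℚ t')
  scale = archimedean-* r δ 0<δ (suc N₀)
  t' : ℕ
  t' = proj₁ scale
  N₀<t' : suc N₀ ≤ t'
  N₀<t' = proj₁ (proj₂ scale)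
  r≤δt' : r ≤ℚ δ *ℚ toℚ t'
  r≤δt' = proj₂ (proj₂ scale)
  open HalfFreeSquare p<q p+q-even S t'
  rounded≤ : ∀ k → (k + q + 1) / 2 * 2 ≤ k + suc q
  rounded≤ k = subst ((k + q + 1) / 2 * 2 ≤_) (trans (ℕ.+-comm (k + q) 1) (sym (ℕ.+-suc k q))) (proj₂ (round-up-even (k + q)))
  1≤t' : 1 ≤ t'
  1≤t' = ℕ.≤-trans (s≤s z≤n) N₀<t'
  1≤A : 1 ≤ A
  1≤A = ℕ.*-mono-≤ {1} {Y} {1} {X} (ℕ.≤-trans (ℕ.≤-trans 1≤m (ℕ.m≤m+n m q)) (proj₁ (round-up-even (m + q))))
                                   (ℕ.≤-trans (ℕ.≤-trans 1≤n (ℕ.m≤m+n n q)) (proj₁ (round-up-even (n + q))))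
  r≤δt : r ≤ℚ δ *ℚ toℚ (suc t')
  r≤δt = ℚ.≤-trans r≤δt' (ℚ.*-monoˡ-≤-nonNeg δ {{0<⇒nonNeg 0<δ}} (toℚ-mono-≤ (ℕ.n≤1+n t')))
  N₀≤N : N₀ ≤ suc t' * A
  N₀≤N = ℕ.≤-trans (ℕ.≤-trans (ℕ.n≤1+n N₀) N₀<t')
           (ℕ.≤-trans (ℕ.n≤1+n t') (ℕ.≤-trans (ℕ.≤-reflexive (sym (ℕ.*-identityʳ t))) (ℕ.*-monoʳ-≤ t 1≤A)))
  count≤ : toℚ ((suc t' * suc t' + t' * t') * (A * V)) ≤ℚ (r ℚ.- δ) *ℚ toℚ ((suc t' * A) * (suc t' * A))
  count≤ = τ-bound (suc t' * A) N₀≤N ((suc t' * suc t' + t' * t') * (A * V)) rotated-square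

snake-length-bound : ∀ {p q m n k} (s : ℚ) (c : ℕ) → 0 < p → p < q → 1 ≤ m →
  (∀ {V} → ConnectedPseudosnake p q m n V → Σ ℕ λ D → (D ≤ (m + c) * (n + c)) × (toℚ V ≤ℚ s *ℚ toℚ D)) →
  Snake p q m n k → toℚ k ≤ℚ (s *ℚ toℚ (m * n)) +ℚ (toℚ (c + c * c) *ℚ toℚ (m + n))
snake-length-bound {p} {q} {m} {n} {k} s c 0<p p<q 1≤m density snake =
  bound (snake⇒connectedPseudosnake 0<p (ℕ.<-trans 0<p p<q) snake)
  where
  bound : (Σ ℕ λ V → ConnectedPseudosnake p q m n V × (k ≤ V) × (1 ≤ V)) →
          toℚ k ≤ℚ (s *ℚ toℚ (m * n)) +ℚ (toℚ (c + c * c) *ℚ toℚ (m + n))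
  bound (V , S , k≤V , 1≤V) =
    let D , D≤ , V≤sD = density S
    in enlarged-box-bound s c k V m n D 1≤V k≤V (ℕ.≤-trans k≤V (ConnectedPseudosnake-size≤area S))
         (ℕ.≤-trans 1≤m (ℕ.m≤m+n m n)) D≤ V≤sD

proposition6 : ∀ (p q : ℕ) → 0 < p → p < q → gcd p q ≡ 1 →
  (IsFree p q → Σ ℕ λ C → ∀ (m n : ℕ) → 1 ≤ m → 1 ≤ n →
     ∀ (r : ℚ) → TauBelow p q r → ∀ (k : ℕ) → Snake p q m n k →
       toℚ k ≤ℚ ((r *ℚ toℚ (m * n)) +ℚ (toℚ C *ℚ toℚ (m + n))))
  ×
  (IsHalfFree p q → Σ ℕ λ C → ∀ (m n : ℕ) → 1 ≤ m → 1 ≤ n →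
     ∀ (r : ℚ) → TauBelow (freeP p q) (freeQ p q) r → ∀ (k : ℕ) → Snake p q m n k →
       toℚ k ≤ℚ (((r *ℚ ½) *ℚ toℚ (m * n)) +ℚ (toℚ C *ℚ toℚ (m + n))))
proposition6 p q 0<p p<q _ =
  (λ _ → q + q * q , λ m n 1≤m 1≤n r τ<r k →
     snake-length-bound r q 0<p p<q 1≤m
       (λ S → (m + q) * (n + q) , ℕ.≤-refl , free-density-bound (ℕ.<⇒≤ p<q) 1≤m 1≤n S r τ<r)) ,
  (λ p+q-even → suc q + suc q * suc q , λ m n 1≤m 1≤n r τ<r k →
     snake-length-bound (r *ℚ ½) (suc q) 0<p p<q 1≤m
       (λ S → half-free-density-bound p<q p+q-even 1≤m 1≤n S r τ<r))
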